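{- For every fixed even positive integer $m$ there exists a constant $C_2(m)>0$ depending only on $m$ such that for every sufficiently large even integer $n$, $$\alpha(m,n)\le C_2(m)\cdot\frac{\binom{m}{m/2}^n}{n^{\frac{m-1}{2}}}.$$
   Context: For positive integers $m,n$, let $A(m,n)$ be the set of all $m\times n$ matrices with every entry in $\{1,-1\}$ such that every row sum and every column sum has absolute value at most $1$, and let $\alpha(m,n)=|A(m,n)|$. -}

module Defs where

open import Data.Bool using (Bool; true; false; _∧_; if_then_else_)
open import Data.Nat using (ℕ; zero; suc; _≤ᵇ_)
open import Data.Integer using (ℤ; +_; -_; _+_; ∣_∣)
open import Data.List using (List; []; _∷_; map; concatMap; filterᵇ; length)
open import Data.Vec using (Vec; []; _∷_; foldr′; transpose)

entry : Bool → ℤ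
entry true  = + 1
entry false = - (+ 1)

allVecs : {A : Set} → List A → (k : ℕ) → List (Vec A k)
allVecs xs zero    = [] ∷ []
allVecs xs (suc k) = concatMap (λ x → map (x ∷_) (allVecs xs k)) xs

allMatrices : (m n : ℕ) → List (Vec (Vec Bool n) m)
allMatrices m n = allVecs (allVecs (true ∷ false ∷ []) n) m

lineSum : {k : ℕ} → Vec Bool k → ℤ
lineSum = foldr′ (λ b s → entry b + s) (+ 0)

smallSum : {k : ℕ} → Vec Bool k → Bool
smallSum v = ∣ lineSum v ∣ ≤ᵇ 1

allV : {A : Set} {k : ℕ} → (A → Bool) → Vec A k → Bool
allV p = foldr′ (λ a r → p a ∧ r) true

inA : {m n : ℕ} → Vec (Vec Bool n) m → Bool
inA M = allV smallSum M ∧ allV smallSum (transpose M)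

α : ℕ → ℕ → ℕ
α m n = length (filterᵇ inA (allMatrices m n))

module Submission where

-- Write m = 2(p+1), d = m - 1 = 2p + 1 and β = C(2p,p).  Reading a matrix of A(m,n)
-- column by column, α(m,n) counts sequences of n balanced columns (exactly p+1 entries
-- +1) whose row sums end in [-1, 1].  A balanced column c is encoded (p+1)-to-one by a
-- triple (ε, j, w): ε is its first entry, j is one of the p+1 rows among 1..d where c
-- carries ¬ε, and w is c with rows 0 and j deleted, a balanced word of length 2p.
-- Dropping the condition on row 0, once the positions js and the words ws are fixed only
-- the signs ε vary, and row b receives a free ±1 exactly from the k_b columns with j = b;
-- so at most M(k_b + 1) sign patterns keep row b small, M(L) being the largest binomial
-- coefficient of order L.  Hence
--   (p+1)ⁿ α ≤ βⁿ P,   P = Σ_{js ∈ [d]ⁿ} Π_b M(k_b(js) + 1).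
-- Cauchy–Schwarz gives P² ≤ dⁿ Σ_js Π_b M(k_b + 1)², and since M(L)² (L+1) ≤ 4^L this
-- last sum is at most 4^d 4ⁿ d^(n+d) / ((n+1)⋯(n+d)).  With (p+1) C(m,p+1) = 2dβ all this
-- combines to α² n^d ≤ 4^d d^d C(m,m/2)^(2n) for every n.

open import Defs
open import Data.Bool using (Bool; true; false; _∧_; not; if_then_else_)
open import Data.Bool.Properties using (∧-identityʳ)
open import Data.Empty using (⊥-elim)
open import Data.Fin using (Fin; zero; suc)
open import Data.Integer as Z using (ℤ; -[1+_]; ∣_∣) renaming (+_ to +ᶻ_)
import Data.Integer.Properties as ZP
import Data.Integer.Tactic.RingSolver as ZR
open import Data.List using (List; []; _∷_; _++_; concatMap; filterᵇ; length)
import Data.List as L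
open import Data.List.Properties using (length-map)
open import Data.Nat
open import Data.Nat.Properties
open import Data.Nat.Combinatorics using (_C_; nCk+nC[k+1]≡[n+1]C[k+1]; k>n⇒nCk≡0)
open import Data.Nat.DivMod using (m*n/n≡m)
open import Data.Nat.Divisibility using (_∣_; divides)
open import Data.Nat.Tactic.RingSolver using (solve-∀)
open import Data.Product using (Σ; _×_; _,_)
open import Data.Sum using (_⊎_; inj₁; inj₂)
open import Data.Vec as V using (Vec; []; _∷_; lookup; insertAt; replicate; zipWith; transpose)
open import Data.Vec.Properties using (lookup-zipWith; lookup-replicate)
open import Relation.Binary.PropositionalEquality

ind : Bool → ℕ
ind true  = 1
ind false = 0

ind≤1 : ∀ b → ind b ≤ 1
ind≤1 true  = ≤-refl
ind≤1 false = z≤n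

ind-∧ : ∀ a b → ind (a ∧ b) ≡ ind a * ind b
ind-∧ true  b = sym (+-identityʳ _)
ind-∧ false b = refl

ΣL : {A : Set} → List A → (A → ℕ) → ℕ
ΣL []       f = 0
ΣL (x ∷ xs) f = f x + ΣL xs f

module _ {A : Set} where

  ΣL-cong : (xs : List A) {f g : A → ℕ} → (∀ x → f x ≡ g x) → ΣL xs f ≡ ΣL xs g
  ΣL-cong []       e = refl
  ΣL-cong (x ∷ xs) e = cong₂ _+_ (e x) (ΣL-cong xs e)

  ΣL-mono : (xs : List A) {f g : A → ℕ} → (∀ x → f x ≤ g x) → ΣL xs f ≤ ΣL xs g
  ΣL-mono []       e = z≤n
  ΣL-mono (x ∷ xs) e = +-mono-≤ (e x) (ΣL-mono xs e)

  ΣL-+ : (xs : List A) (f g : A → ℕ) → ΣL xs (λ x → f x + g x) ≡ ΣL xs f + ΣL xs g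
  ΣL-+ []       f g = refl
  ΣL-+ (x ∷ xs) f g rewrite ΣL-+ xs f g = +-interchange (f x) (g x) (ΣL xs f) (ΣL xs g)
    where
    +-interchange : ∀ a b c d → a + b + (c + d) ≡ a + c + (b + d)
    +-interchange = solve-∀

  ΣL-* : (xs : List A) (c : ℕ) (f : A → ℕ) → ΣL xs (λ x → c * f x) ≡ c * ΣL xs f
  ΣL-* []       c f = sym (*-zeroʳ c)
  ΣL-* (x ∷ xs) c f rewrite ΣL-* xs c f = sym (*-distribˡ-+ c (f x) (ΣL xs f))

  ΣL-const : (xs : List A) (c : ℕ) → ΣL xs (λ _ → c) ≡ length xs * c
  ΣL-const []       c = refl
  ΣL-const (x ∷ xs) c = cong (c +_) (ΣL-const xs c)

  ΣL-++ : (xs ys : List A) (f : A → ℕ) → ΣL (xs ++ ys) f ≡ ΣL xs f + ΣL ys f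
  ΣL-++ []       ys f = refl
  ΣL-++ (x ∷ xs) ys f rewrite ΣL-++ xs ys f = sym (+-assoc (f x) (ΣL xs f) (ΣL ys f))

  length-filter : (p : A → Bool) (xs : List A) → length (filterᵇ p xs) ≡ ΣL xs (λ x → ind (p x))
  length-filter p []       = refl
  length-filter p (x ∷ xs) with p x
  ... | true  = cong suc (length-filter p xs)
  ... | false = length-filter p xs

  ΣL-filter : (p : A → Bool) (xs : List A) (f : A → ℕ) →
              ΣL (filterᵇ p xs) f ≡ ΣL xs (λ x → ind (p x) * f x)
  ΣL-filter p []       f = refl
  ΣL-filter p (x ∷ xs) f with p x
  ... | true  = cong₂ _+_ (sym (+-identityʳ (f x))) (ΣL-filter p xs f)
  ... | false = ΣL-filter p xs f

ΣL-map : {A B : Set} (h : A → B) (xs : List A) (f : B → ℕ) → ΣL (L.map h xs) f ≡ ΣL xs (λ x → f (h x))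
ΣL-map h []       f = refl
ΣL-map h (x ∷ xs) f = cong (f (h x) +_) (ΣL-map h xs f)

ΣL-concatMap : {A B : Set} (g : A → List B) (xs : List A) (f : B → ℕ) →
               ΣL (concatMap g xs) f ≡ ΣL xs (λ x → ΣL (g x) f)
ΣL-concatMap g []       f = refl
ΣL-concatMap g (x ∷ xs) f =
  trans (ΣL-++ (g x) (concatMap g xs) f) (cong (ΣL (g x) f +_) (ΣL-concatMap g xs f))

ΣL-swap : {A B : Set} (xs : List A) (ys : List B) (f : A → B → ℕ) →
          ΣL xs (λ x → ΣL ys (f x)) ≡ ΣL ys (λ y → ΣL xs (λ x → f x y))
ΣL-swap []       ys f = sym (trans (ΣL-const ys 0) (*-zeroʳ (length ys)))
ΣL-swap (x ∷ xs) ys f =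
  trans (cong (ΣL ys (f x) +_) (ΣL-swap xs ys f)) (sym (ΣL-+ ys (f x) (λ y → ΣL xs (λ x' → f x' y))))

ΣV : {A : Set} → List A → (n : ℕ) → (Vec A n → ℕ) → ℕ
ΣV xs zero    f = f []
ΣV xs (suc n) f = ΣL xs (λ x → ΣV xs n (λ v → f (x ∷ v)))

module _ {A : Set} (xs : List A) where

  ΣV-cong : ∀ n {f g : Vec A n → ℕ} → (∀ v → f v ≡ g v) → ΣV xs n f ≡ ΣV xs n g
  ΣV-cong zero    e = e []
  ΣV-cong (suc n) e = ΣL-cong xs (λ x → ΣV-cong n (λ v → e (x ∷ v)))

  ΣV-mono : ∀ n {f g : Vec A n → ℕ} → (∀ v → f v ≤ g v) → ΣV xs n f ≤ ΣV xs n g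
  ΣV-mono zero    e = e []
  ΣV-mono (suc n) e = ΣL-mono xs (λ x → ΣV-mono n (λ v → e (x ∷ v)))

  ΣV-+ : ∀ n (f g : Vec A n → ℕ) → ΣV xs n (λ v → f v + g v) ≡ ΣV xs n f + ΣV xs n g
  ΣV-+ zero    f g = refl
  ΣV-+ (suc n) f g = trans (ΣL-cong xs (λ x → ΣV-+ n (λ v → f (x ∷ v)) (λ v → g (x ∷ v))))
                           (ΣL-+ xs (λ x → ΣV xs n (λ v → f (x ∷ v))) (λ x → ΣV xs n (λ v → g (x ∷ v))))

  ΣV-* : ∀ n (c : ℕ) (f : Vec A n → ℕ) → ΣV xs n (λ v → c * f v) ≡ c * ΣV xs n f
  ΣV-* zero    c f = refl
  ΣV-* (suc n) c f = trans (ΣL-cong xs (λ x → ΣV-* n c (λ v → f (x ∷ v)))) (ΣL-* xs c _)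

  ΣV-const : ∀ n (c : ℕ) → ΣV xs n (λ _ → c) ≡ length xs ^ n * c
  ΣV-const zero    c = sym (+-identityʳ c)
  ΣV-const (suc n) c = begin
    ΣL xs (λ x → ΣV xs n (λ _ → c)) ≡⟨ ΣL-cong xs (λ x → ΣV-const n c) ⟩
    ΣL xs (λ x → length xs ^ n * c) ≡⟨ ΣL-const xs _ ⟩
    length xs * (length xs ^ n * c) ≡⟨ sym (*-assoc (length xs) _ c) ⟩
    length xs ^ suc n * c           ∎
    where open ≡-Reasoning

  ΣL-allVecs : ∀ n (f : Vec A n → ℕ) → ΣL (allVecs xs n) f ≡ ΣV xs n f
  ΣL-allVecs zero    f = +-identityʳ (f [])
  ΣL-allVecs (suc n) f =
    trans (ΣL-concatMap _ xs f)
          (ΣL-cong xs (λ x → trans (ΣL-map (x ∷_) (allVecs xs n) f) (ΣL-allVecs n _)))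

ΣLV-swap : {A B : Set} (xs : List A) (ys : List B) (n : ℕ) (f : A → Vec B n → ℕ) →
           ΣL xs (λ x → ΣV ys n (f x)) ≡ ΣV ys n (λ v → ΣL xs (λ x → f x v))
ΣLV-swap xs ys zero    f = refl
ΣLV-swap xs ys (suc n) f =
  trans (ΣL-swap xs ys _) (ΣL-cong ys (λ y → ΣLV-swap xs ys n (λ x v → f x (y ∷ v))))

ΣVV-swap : {A B : Set} (xs : List A) (ys : List B) (m n : ℕ) (f : Vec A m → Vec B n → ℕ) →
           ΣV xs m (λ u → ΣV ys n (f u)) ≡ ΣV ys n (λ v → ΣV xs m (λ u → f u v))
ΣVV-swap xs ys zero    n f = refl
ΣVV-swap xs ys (suc m) n f =
  trans (ΣL-cong xs (λ x → ΣVV-swap xs ys m n (λ u v → f (x ∷ u) v))) (ΣLV-swap xs ys n _)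

sq : ℕ → ℕ
sq a = a * a

2ab≤a²+b²-ordered : ∀ {a b} → a ≤ b → 2 * a * b ≤ sq a + sq b
2ab≤a²+b²-ordered {a} {b} a≤b = subst (λ c → 2 * a * c ≤ sq a + sq c) (m+[n∸m]≡n a≤b)
  (subst (2 * a * (a + (b ∸ a)) ≤_) (square-gap a (b ∸ a)) (m≤m+n _ _))
  where
  square-gap : ∀ a k → 2 * a * (a + k) + k * k ≡ a * a + (a + k) * (a + k)
  square-gap = solve-∀

2ab≤a²+b² : ∀ a b → 2 * a * b ≤ sq a + sq b
2ab≤a²+b² a b with ≤-total a b
... | inj₁ a≤b = 2ab≤a²+b²-ordered a≤b
... | inj₂ b≤a = subst₂ _≤_ (swap b a) (+-comm (sq b) (sq a)) (2ab≤a²+b²-ordered b≤a)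
  where
  swap : ∀ a b → 2 * a * b ≡ 2 * b * a
  swap = solve-∀

cauchy-schwarz-step : {A : Set} (xs : List A) (a : A → ℕ) (c : ℕ) →
                      2 * c * ΣL xs a ≤ length xs * sq c + ΣL xs (λ x → sq (a x))
cauchy-schwarz-step []       a c = ≤-reflexive (*-zeroʳ (2 * c))
cauchy-schwarz-step (x ∷ xs) a c = begin
  2 * c * (a x + ΣL xs a)                                        ≡⟨ *-distribˡ-+ (2 * c) (a x) (ΣL xs a) ⟩
  2 * c * a x + 2 * c * ΣL xs a                                  ≤⟨ +-mono-≤ (2ab≤a²+b² c (a x)) (cauchy-schwarz-step xs a c) ⟩
  (sq c + sq (a x)) + (length xs * sq c + ΣL xs (λ x → sq (a x))) ≡⟨ +-interchange (sq c) (sq (a x)) (length xs * sq c) _ ⟩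
  (sq c + length xs * sq c) + (sq (a x) + ΣL xs (λ x → sq (a x))) ∎
  where
  open ≤-Reasoning
  +-interchange : ∀ a b c d → (a + b) + (c + d) ≡ (a + c) + (b + d)
  +-interchange = solve-∀

cauchy-schwarz : {A : Set} (xs : List A) (a : A → ℕ) → sq (ΣL xs a) ≤ length xs * ΣL xs (λ x → sq (a x))
cauchy-schwarz []       a = z≤n
cauchy-schwarz (x ∷ xs) a = begin
  (a x + S) * (a x + S)                                  ≡⟨ expand (a x) S ⟩
  sq (a x) + 2 * a x * S + sq S                          ≤⟨ +-mono-≤ (+-monoʳ-≤ (sq (a x)) (cauchy-schwarz-step xs a (a x)))
                                                                      (cauchy-schwarz xs a) ⟩
  sq (a x) + (length xs * sq (a x) + Q) + length xs * Q ≡⟨ collect (sq (a x)) (length xs) Q ⟩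
  (1 + length xs) * (sq (a x) + Q)                       ∎
  where
  open ≤-Reasoning
  S = ΣL xs a
  Q = ΣL xs (λ x → sq (a x))
  expand : ∀ a s → (a + s) * (a + s) ≡ a * a + 2 * a * s + s * s
  expand = solve-∀
  collect : ∀ a l q → a + (l * a + q) + l * q ≡ (1 + l) * (a + q)
  collect = solve-∀

ΣV-cauchy-schwarz : {A : Set} (xs : List A) (n : ℕ) (a : Vec A n → ℕ) →
                    sq (ΣV xs n a) ≤ length xs ^ n * ΣV xs n (λ v → sq (a v))
ΣV-cauchy-schwarz xs zero    a = ≤-reflexive (sym (+-identityʳ _))
ΣV-cauchy-schwarz xs (suc n) a = begin
  sq (ΣL xs (λ x → ΣV xs n (λ v → a (x ∷ v))))
    ≤⟨ cauchy-schwarz xs _ ⟩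
  k * ΣL xs (λ x → sq (ΣV xs n (λ v → a (x ∷ v))))
    ≤⟨ *-monoʳ-≤ k (ΣL-mono xs (λ x → ΣV-cauchy-schwarz xs n (λ v → a (x ∷ v)))) ⟩
  k * ΣL xs (λ x → k ^ n * ΣV xs n (λ v → sq (a (x ∷ v))))
    ≡⟨ cong (k *_) (ΣL-* xs (k ^ n) (λ x → ΣV xs n (λ v → sq (a (x ∷ v))))) ⟩
  k * (k ^ n * ΣV xs (suc n) (λ v → sq (a v)))
    ≡⟨ sym (*-assoc k _ _) ⟩
  k ^ suc n * ΣV xs (suc n) (λ v → sq (a v)) ∎
  where
  open ≤-Reasoning
  k = length xs

-- Counting the matrices of A(m,n) column by column.

signs : List Bool
signs = true ∷ false ∷ []

small : ℤ → Bool
small z = ∣ z ∣ ≤ᵇ 1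

allSmall : ∀ {m} → Vec ℤ m → Bool
allSmall []       = true
allSmall (z ∷ zs) = small z ∧ allSmall zs

_⊕_ : ∀ {m} → Vec ℤ m → Vec Bool m → Vec ℤ m
s ⊕ c = zipWith (λ z b → z Z.+ entry b) s c

rowsFit : ∀ {m n} → Vec ℤ m → Vec (Vec Bool n) m → Bool
rowsFit []       []      = true
rowsFit (s ∷ ss) (r ∷ M) = small (lineSum r Z.+ s) ∧ rowsFit ss M

fits : ∀ {m n} → Vec ℤ m → Vec (Vec Bool n) m → Bool
fits s M = rowsFit s M ∧ allV smallSum (transpose M)

extensions : (m n : ℕ) → Vec ℤ m → ℕ
extensions m zero    s = ind (allSmall s)
extensions m (suc n) s = ΣV signs m (λ c → ind (smallSum c) * extensions m n (s ⊕ c))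

ΣM : (m n : ℕ) → (Vec (Vec Bool n) m → ℕ) → ℕ
ΣM zero    n g = g []
ΣM (suc m) n g = ΣV signs n (λ r → ΣM m n (λ M → g (r ∷ M)))

ΣM-cong : ∀ m n {f g : Vec (Vec Bool n) m → ℕ} → (∀ M → f M ≡ g M) → ΣM m n f ≡ ΣM m n g
ΣM-cong zero    n e = e []
ΣM-cong (suc m) n e = ΣV-cong signs n (λ r → ΣM-cong m n (λ M → e (r ∷ M)))

ΣM-* : ∀ m n (k : ℕ) (f : Vec (Vec Bool n) m → ℕ) → ΣM m n (λ M → k * f M) ≡ k * ΣM m n f
ΣM-* zero    n k f = refl
ΣM-* (suc m) n k f = trans (ΣV-cong signs n (λ r → ΣM-* m n k _)) (ΣV-* signs n k _)

ΣV-allVecs≡ΣM : ∀ m n (g : Vec (Vec Bool n) m → ℕ) → ΣV (allVecs signs n) m g ≡ ΣM m n g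
ΣV-allVecs≡ΣM zero    n g = refl
ΣV-allVecs≡ΣM (suc m) n g = trans (ΣL-cong (allVecs signs n) (λ r → ΣV-allVecs≡ΣM m n (λ M → g (r ∷ M))))
                                  (ΣL-allVecs signs n _)

ΣM-first-column : ∀ m n (g : Vec (Vec Bool (suc n)) m → ℕ) →
                  ΣM m (suc n) g ≡ ΣV signs m (λ c → ΣM m n (λ M → g (zipWith _∷_ c M)))
ΣM-first-column zero    n g = refl
ΣM-first-column (suc m) n g =
  trans (ΣL-cong signs (λ x → ΣV-cong signs n (λ r → ΣM-first-column m n (λ M → g ((x ∷ r) ∷ M)))))
        (ΣL-cong signs (λ x → ΣVV-swap signs signs n m (λ r c → ΣM m n (λ M → g ((x ∷ r) ∷ zipWith _∷_ c M)))))

ΣM-no-columns : ∀ m (g : Vec (Vec Bool zero) m → ℕ) → ΣM m zero g ≡ g (replicate m [])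
ΣM-no-columns zero    g = refl
ΣM-no-columns (suc m) g = ΣM-no-columns m (λ M → g ([] ∷ M))

transpose-first-column : ∀ {m n} (c : Vec Bool m) (M : Vec (Vec Bool n) m) →
                         transpose (zipWith _∷_ c M) ≡ c ∷ transpose M
transpose-first-column []      []      = refl
transpose-first-column (x ∷ c) (r ∷ M) rewrite transpose-first-column c M = refl

transpose-no-columns : ∀ m → transpose (replicate m ([] {A = Bool})) ≡ []
transpose-no-columns zero    = refl
transpose-no-columns (suc m) rewrite transpose-no-columns m = refl

rowsFit-first-column : ∀ {m n} (s : Vec ℤ m) (c : Vec Bool m) (M : Vec (Vec Bool n) m) →
                       rowsFit s (zipWith _∷_ c M) ≡ rowsFit (s ⊕ c) M
rowsFit-first-column []       []      []      = refl
rowsFit-first-column (s ∷ ss) (x ∷ c) (r ∷ M) =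
  cong₂ _∧_ (cong small (shift (entry x) (lineSum r) s)) (rowsFit-first-column ss c M)
  where
  shift : ∀ a b s → (a Z.+ b) Z.+ s ≡ b Z.+ (s Z.+ a)
  shift = ZR.solve-∀

fits-first-column : ∀ {m n} (s : Vec ℤ m) (c : Vec Bool m) (M : Vec (Vec Bool n) m) →
                    ind (fits s (zipWith _∷_ c M)) ≡ ind (smallSum c) * ind (fits (s ⊕ c) M)
fits-first-column s c M rewrite rowsFit-first-column s c M | transpose-first-column c M =
  reorder (rowsFit (s ⊕ c) M) (smallSum c) _
  where
  reorder : ∀ a b c → ind (a ∧ (b ∧ c)) ≡ ind b * ind (a ∧ c)
  reorder a     true  c = sym (+-identityʳ _)
  reorder true  false c = refl
  reorder false false c = refl

rowsFit-no-columns : ∀ {m} (s : Vec ℤ m) → rowsFit s (replicate m []) ≡ allSmall s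
rowsFit-no-columns []       = refl
rowsFit-no-columns (s ∷ ss) = cong₂ _∧_ (cong small (ZP.+-identityˡ s)) (rowsFit-no-columns ss)

fits-no-columns : ∀ {m} (s : Vec ℤ m) → fits s (replicate m []) ≡ allSmall s
fits-no-columns {m} s rewrite transpose-no-columns m | rowsFit-no-columns s = ∧-identityʳ (allSmall s)

ΣM-fits≡extensions : ∀ m n (s : Vec ℤ m) → ΣM m n (λ M → ind (fits s M)) ≡ extensions m n s
ΣM-fits≡extensions m zero    s = trans (ΣM-no-columns m _) (cong ind (fits-no-columns s))
ΣM-fits≡extensions m (suc n) s = trans (ΣM-first-column m n _) (ΣV-cong signs m (λ c → begin
  ΣM m n (λ M → ind (fits s (zipWith _∷_ c M)))             ≡⟨ ΣM-cong m n (fits-first-column s c) ⟩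
  ΣM m n (λ M → ind (smallSum c) * ind (fits (s ⊕ c) M))    ≡⟨ ΣM-* m n (ind (smallSum c)) _ ⟩
  ind (smallSum c) * ΣM m n (λ M → ind (fits (s ⊕ c) M))    ≡⟨ cong (ind (smallSum c) *_) (ΣM-fits≡extensions m n (s ⊕ c)) ⟩
  ind (smallSum c) * extensions m n (s ⊕ c)                 ∎))
  where open ≡-Reasoning

α≡extensions : ∀ m n → α m n ≡ extensions m n (replicate m (+ᶻ 0))
α≡extensions m n = begin
  length (filterᵇ inA (allMatrices m n))                ≡⟨ length-filter inA (allMatrices m n) ⟩
  ΣL (allMatrices m n) (λ M → ind (inA M))              ≡⟨ ΣL-allVecs (allVecs signs n) m _ ⟩
  ΣV (allVecs signs n) m (λ M → ind (inA M))            ≡⟨ ΣV-allVecs≡ΣM m n _ ⟩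
  ΣM m n (λ M → ind (inA M))                            ≡⟨ ΣM-cong m n (λ M → cong (λ b → ind (b ∧ allV smallSum (transpose M))) (rows-zero M)) ⟩
  ΣM m n (λ M → ind (fits (replicate m (+ᶻ 0)) M))       ≡⟨ ΣM-fits≡extensions m n _ ⟩
  extensions m n (replicate m (+ᶻ 0))                    ∎
  where
  open ≡-Reasoning
  rows-zero : ∀ {m n} (M : Vec (Vec Bool n) m) → allV smallSum M ≡ rowsFit (replicate m (+ᶻ 0)) M
  rows-zero []      = refl
  rows-zero (r ∷ M) = cong₂ _∧_ (cong small (sym (ZP.+-identityʳ (lineSum r)))) (rows-zero M)

-- Binomial coefficients.

bin : ℕ → ℕ → ℕ
bin zero    zero    = 1
bin zero    (suc k) = 0
bin (suc n) zero    = 1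
bin (suc n) (suc k) = bin n k + bin n (suc k)

bin-0 : ∀ n → bin n 0 ≡ 1
bin-0 zero    = refl
bin-0 (suc n) = refl

bin-big : ∀ n k → n < k → bin n k ≡ 0
bin-big zero    (suc k) _         = refl
bin-big (suc n) (suc k) (s≤s n<k) = cong₂ _+_ (bin-big n k n<k) (bin-big n (suc k) (m≤n⇒m≤1+n n<k))

C≡bin : ∀ n k → n C k ≡ bin n k
C≡bin zero    zero    = refl
C≡bin zero    (suc k) = k>n⇒nCk≡0 {0} {suc k} (s≤s z≤n)
C≡bin (suc n) zero    = refl
C≡bin (suc n) (suc k) = trans (sym (nCk+nC[k+1]≡[n+1]C[k+1] n k)) (cong₂ _+_ (C≡bin n k) (C≡bin n (suc k)))

-- The symmetric form bin₂ a b = C(a+b, a), convenient for recursion on both arguments.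
bin₂ : ℕ → ℕ → ℕ
bin₂ zero    b       = 1
bin₂ (suc a) zero    = 1
bin₂ (suc a) (suc b) = bin₂ a (suc b) + bin₂ (suc a) b

bin≡bin₂ : ∀ a b → bin (a + b) a ≡ bin₂ a b
bin≡bin₂ zero    b       = bin-0 b
bin≡bin₂ (suc a) zero    =
  trans (cong₂ _+_ (bin≡bin₂ a zero) (bin-big (a + 0) (suc a) (s≤s (≤-reflexive (+-identityʳ a)))))
        (trans (+-identityʳ _) (bin₂-0 a))
  where
  bin₂-0 : ∀ a → bin₂ a 0 ≡ 1
  bin₂-0 zero    = refl
  bin₂-0 (suc a) = refl
bin≡bin₂ (suc a) (suc b) =
  cong₂ _+_ (bin≡bin₂ a (suc b)) (trans (cong (λ t → bin t (suc a)) (+-suc a b)) (bin≡bin₂ (suc a) b))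

bin₂-sym : ∀ a b → bin₂ a b ≡ bin₂ b a
bin₂-sym zero    zero    = refl
bin₂-sym zero    (suc b) = refl
bin₂-sym (suc a) zero    = refl
bin₂-sym (suc a) (suc b) =
  trans (cong₂ _+_ (bin₂-sym a (suc b)) (bin₂-sym (suc a) b)) (+-comm (bin₂ (suc b) a) (bin₂ b (suc a)))

bin₂-absorb : ∀ a b → bin₂ a b * (a + b + 1) ≡ bin₂ (suc a) b * suc a
bin₂-absorb zero    b       = trans (+-identityʳ (b + 1)) (trans (+-comm b 1) (sym (trans (*-identityʳ _) (bin₂-1 b))))
  where
  bin₂-1 : ∀ b → bin₂ 1 b ≡ suc b
  bin₂-1 zero    = refl
  bin₂-1 (suc b) = cong suc (bin₂-1 b)
bin₂-absorb (suc a) zero    = trans (cong (λ t → suc (t + 1 + 0)) (+-identityʳ a)) (arith a)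
  where
  arith : ∀ a → suc (a + 1 + 0) ≡ suc (suc a) + 0
  arith = solve-∀
bin₂-absorb (suc a) (suc b) = begin
  (X + Y) * (suc a + suc b + 1)                    ≡⟨ split X Y a b ⟩
  X * (a + suc b + 1) + Y * (suc a + b + 1) + (X + Y) ≡⟨ cong₂ (λ u v → u + v + (X + Y)) (bin₂-absorb a (suc b)) (bin₂-absorb (suc a) b) ⟩
  (X + Y) * suc a + W * suc (suc a) + (X + Y)       ≡⟨ merge (X + Y) W a ⟩
  ((X + Y) + W) * suc (suc a)                      ∎
  where
  open ≡-Reasoning
  X = bin₂ a (suc b)
  Y = bin₂ (suc a) b
  W = bin₂ (suc (suc a)) b
  split : ∀ X Y a b → (X + Y) * (suc a + suc b + 1) ≡ X * (a + suc b + 1) + Y * (suc a + b + 1) + (X + Y)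
  split = solve-∀
  merge : ∀ Z W a → Z * suc a + W * suc (suc a) + Z ≡ (Z + W) * suc (suc a)
  merge = solve-∀

bin₂-shift : ∀ a b → bin₂ a (suc b) * suc b ≡ bin₂ (suc a) b * suc a
bin₂-shift a b = begin
  bin₂ a (suc b) * suc b   ≡⟨ cong (_* suc b) (bin₂-sym a (suc b)) ⟩
  bin₂ (suc b) a * suc b   ≡⟨ sym (bin₂-absorb b a) ⟩
  bin₂ b a * (b + a + 1)   ≡⟨ cong₂ _*_ (bin₂-sym b a) (cong (_+ 1) (+-comm b a)) ⟩
  bin₂ a b * (a + b + 1)   ≡⟨ bin₂-absorb a b ⟩
  bin₂ (suc a) b * suc a   ∎
  where open ≡-Reasoning

bin₂-unimodal : ∀ a c → a ≤ c → bin₂ a (suc c) ≤ bin₂ (suc a) c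
bin₂-unimodal a c a≤c = *-cancelʳ-≤ (bin₂ a (suc c)) (bin₂ (suc a) c) (suc c)
  (≤-trans (≤-reflexive (bin₂-shift a c)) (*-monoʳ-≤ (bin₂ (suc a) c) (s≤s a≤c)))

maxBin : ℕ → ℕ
maxBin L = bin₂ ⌊ L /2⌋ ⌈ L /2⌉

maxBin-even : ∀ a → maxBin (a + a) ≡ bin₂ a a
maxBin-even a rewrite sym (n≡⌊n+n/2⌋ a) | sym (n≡⌈n+n/2⌉ a) = refl

maxBin-odd : ∀ a → maxBin (suc (a + a)) ≡ bin₂ a (suc a)
maxBin-odd a rewrite sym (n≡⌈n+n/2⌉ a) | sym (n≡⌊n+n/2⌋ a) = refl

bin₂≤maxBin-ordered : ∀ t a → bin₂ a (a + t) ≤ maxBin (a + (a + t))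
bin₂≤maxBin-ordered zero          a rewrite +-identityʳ a | maxBin-even a = ≤-refl
bin₂≤maxBin-ordered (suc zero)    a rewrite +-comm a 1 | +-suc a a | maxBin-odd a = ≤-refl
bin₂≤maxBin-ordered (suc (suc t)) a = begin
  bin₂ a (a + suc (suc t))        ≡⟨ cong (bin₂ a) (+-suc a (suc t)) ⟩
  bin₂ a (suc (a + suc t))        ≤⟨ bin₂-unimodal a (a + suc t) (m≤m+n a _) ⟩
  bin₂ (suc a) (a + suc t)        ≡⟨ cong (bin₂ (suc a)) (+-suc a t) ⟩
  bin₂ (suc a) (suc a + t)        ≤⟨ bin₂≤maxBin-ordered t (suc a) ⟩
  maxBin (suc a + (suc a + t))    ≡⟨ cong maxBin (arith a t) ⟩
  maxBin (a + (a + suc (suc t)))  ∎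
  where
  open ≤-Reasoning
  arith : ∀ a t → suc a + (suc a + t) ≡ a + (a + suc (suc t))
  arith = solve-∀

bin₂≤maxBin : ∀ a b → bin₂ a b ≤ maxBin (a + b)
bin₂≤maxBin a b with ≤-total a b
... | inj₁ a≤b = subst (λ t → bin₂ a t ≤ maxBin (a + t)) (m+[n∸m]≡n a≤b) (bin₂≤maxBin-ordered (b ∸ a) a)
... | inj₂ b≤a = subst₂ _≤_ (bin₂-sym b a) (cong maxBin (+-comm b a))
  (subst (λ t → bin₂ b t ≤ maxBin (b + t)) (m+[n∸m]≡n b≤a) (bin₂≤maxBin-ordered (a ∸ b) b))

bin≤maxBin : ∀ L i → bin L i ≤ maxBin L
bin≤maxBin L i with ≤-total i L
... | inj₁ i≤L = subst (λ t → bin t i ≤ maxBin t) (m+[n∸m]≡n i≤L)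
                   (subst (_≤ maxBin (i + (L ∸ i))) (sym (bin≡bin₂ i (L ∸ i))) (bin₂≤maxBin i (L ∸ i)))
... | inj₂ L≤i with m≤n⇒m<n∨m≡n L≤i
...   | inj₁ L<i  = subst (_≤ maxBin L) (sym (bin-big L i L<i)) z≤n
...   | inj₂ refl = subst₂ _≤_ (sym diagonal) (cong maxBin (+-identityʳ L)) (bin₂≤maxBin L 0)
  where
  diagonal : bin L L ≡ bin₂ L 0
  diagonal = trans (cong (λ t → bin t L) (sym (+-identityʳ L))) (bin≡bin₂ L 0)

central-step : ∀ j → bin₂ (suc j) (suc j) * suc j ≡ 2 * (j + j + 1) * bin₂ j j
central-step j = begin
  (bin₂ j (suc j) + X) * suc j   ≡⟨ cong (λ t → (t + X) * suc j) (bin₂-sym j (suc j)) ⟩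
  (X + X) * suc j                ≡⟨ double X (suc j) ⟩
  2 * (X * suc j)                ≡⟨ cong (2 *_) (sym (bin₂-absorb j j)) ⟩
  2 * (bin₂ j j * (j + j + 1))   ≡⟨ reorder (bin₂ j j) (j + j + 1) ⟩
  2 * (j + j + 1) * bin₂ j j     ∎
  where
  open ≡-Reasoning
  X = bin₂ (suc j) j
  double : ∀ X s → (X + X) * s ≡ 2 * (X * s)
  double = solve-∀
  reorder : ∀ b s → 2 * (b * s) ≡ 2 * s * b
  reorder = solve-∀

-- The central binomial coefficient: C(2j, j)² (3j+1) ≤ 16^j.  Induction works because
-- the ratio of consecutive left-hand sides, 4 (2j+1)² (3j+4) / ((j+1)² (3j+1)), is at most 16.
central-bound : ∀ j → bin₂ j j * bin₂ j j * suc (3 * j) ≤ 16 ^ j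
central-bound zero    = ≤-refl
central-bound (suc j) = *-cancelʳ-≤ (B * B * suc (3 * suc j)) (16 ^ suc j) Q (begin
  B * B * suc (3 * suc j) * Q
    ≡⟨ regroup B j ⟩
  (B * suc j) * (B * suc j) * ((3 * j + 4) * suc (3 * j))
    ≡⟨ cong (λ t → t * t * ((3 * j + 4) * suc (3 * j))) (central-step j) ⟩
  (2 * (j + j + 1) * b) * (2 * (j + j + 1) * b) * ((3 * j + 4) * suc (3 * j))
    ≡⟨ regroup′ b j ⟩
  (b * b * suc (3 * j)) * (4 * ((2 * j + 1) * (2 * j + 1)) * (3 * j + 4))
    ≤⟨ *-monoˡ-≤ _ (central-bound j) ⟩
  16 ^ j * (4 * ((2 * j + 1) * (2 * j + 1)) * (3 * j + 4))
    ≤⟨ *-monoʳ-≤ (16 ^ j) (≤-trans (m≤m+n _ (4 * j)) (≤-reflexive (ratio j))) ⟩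
  16 ^ j * (16 * Q)
    ≡⟨ reorder (16 ^ j) Q ⟩
  16 ^ suc j * Q ∎)
  where
  open ≤-Reasoning
  B = bin₂ (suc j) (suc j)
  b = bin₂ j j
  Q = suc j * suc j * suc (3 * j)
  regroup : ∀ B j → B * B * suc (3 * suc j) * (suc j * suc j * suc (3 * j)) ≡
                    (B * suc j) * (B * suc j) * ((3 * j + 4) * suc (3 * j))
  regroup = solve-∀
  regroup′ : ∀ b j → (2 * (j + j + 1) * b) * (2 * (j + j + 1) * b) * ((3 * j + 4) * suc (3 * j)) ≡
                     (b * b * suc (3 * j)) * (4 * ((2 * j + 1) * (2 * j + 1)) * (3 * j + 4))
  regroup′ = solve-∀
  ratio : ∀ j → 4 * ((2 * j + 1) * (2 * j + 1)) * (3 * j + 4) + 4 * j ≡ 16 * (suc j * suc j * suc (3 * j))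
  ratio = solve-∀
  reorder : ∀ x q → x * (16 * q) ≡ 16 * x * q
  reorder = solve-∀

4^[j+j]≡16^j : ∀ j → 4 ^ (j + j) ≡ 16 ^ j
4^[j+j]≡16^j zero    = refl
4^[j+j]≡16^j (suc j) rewrite +-suc j j = trans (sym (*-assoc 4 4 (4 ^ (j + j)))) (cong (16 *_) (4^[j+j]≡16^j j))

even-or-odd : ∀ L → Σ ℕ (λ j → L ≡ j + j ⊎ L ≡ suc (j + j))
even-or-odd zero    = 0 , inj₁ refl
even-or-odd (suc L) with even-or-odd L
... | j , inj₁ e = j , inj₂ (cong suc e)
... | j , inj₂ e = suc j , inj₁ (trans (cong suc e) (cong suc (sym (+-suc j j))))

maxBin-bound : ∀ L → maxBin L * maxBin L * suc L ≤ 4 ^ L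
maxBin-bound L with even-or-odd L
... | j , inj₁ refl = begin
  maxBin (j + j) * maxBin (j + j) * suc (j + j) ≡⟨ cong (λ t → t * t * suc (j + j)) (maxBin-even j) ⟩
  b * b * suc (j + j)                           ≤⟨ *-monoʳ-≤ (b * b) (s≤s (≤-trans (m≤m+n (j + j) j) (≤-reflexive (triple j)))) ⟩
  b * b * suc (3 * j)                           ≤⟨ central-bound j ⟩
  16 ^ j                                        ≡⟨ sym (4^[j+j]≡16^j j) ⟩
  4 ^ (j + j)                                   ∎
  where
  open ≤-Reasoning
  b = bin₂ j j
  triple : ∀ j → j + j + j ≡ 3 * j
  triple = solve-∀
... | j , inj₂ refl = *-cancelʳ-≤ (maxBin (suc (j + j)) * maxBin (suc (j + j)) * suc (suc (j + j))) (4 ^ suc (j + j)) 4 (begin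
  maxBin (suc (j + j)) * maxBin (suc (j + j)) * suc (suc (j + j)) * 4 ≡⟨ cong (λ t → t * t * suc (suc (j + j)) * 4) (maxBin-odd j) ⟩
  c * c * suc (suc (j + j)) * 4           ≡⟨ double c j ⟩
  (c + c) * (c + c) * suc (suc (j + j))   ≤⟨ *-monoʳ-≤ ((c + c) * (c + c)) (≤-trans (m≤m+n _ (j + 2)) (≤-reflexive (linear j))) ⟩
  (c + c) * (c + c) * suc (3 * suc j)     ≡⟨ cong (λ t → (c + t) * (c + t) * suc (3 * suc j)) (bin₂-sym j (suc j)) ⟩
  B * B * suc (3 * suc j)                 ≤⟨ central-bound (suc j) ⟩
  16 ^ suc j                              ≡⟨ sym (4^[j+j]≡16^j (suc j)) ⟩
  4 ^ (suc j + suc j)                     ≡⟨ cong (4 ^_) (cong suc (+-suc j j)) ⟩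
  4 * 4 ^ suc (j + j)                     ≡⟨ *-comm 4 (4 ^ suc (j + j)) ⟩
  4 ^ suc (j + j) * 4                     ∎)
  where
  open ≤-Reasoning
  c = bin₂ j (suc j)
  B = bin₂ (suc j) (suc j)
  double : ∀ c j → c * c * suc (suc (j + j)) * 4 ≡ (c + c) * (c + c) * suc (suc (j + j))
  double = solve-∀
  linear : ∀ j → suc (suc (j + j)) + (j + 2) ≡ suc (3 * suc j)
  linear = solve-∀

-- Sums over the profiles of position sequences.

-- splitSum n H = Σ_{i+l=n} C(n,i) H i l: the sum of H over all ways of marking each of
-- n ordered items as "first kind" (counted by i) or "second kind" (counted by l).
splitSum : ℕ → (ℕ → ℕ → ℕ) → ℕ
splitSum zero    H = H 0 0
splitSum (suc n) H = splitSum n (λ i l → H (suc i) l) + splitSum n (λ i l → H i (suc l))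

splitSum-cong : ∀ n {H G : ℕ → ℕ → ℕ} → (∀ i l → i + l ≡ n → H i l ≡ G i l) → splitSum n H ≡ splitSum n G
splitSum-cong zero    e = e 0 0 refl
splitSum-cong (suc n) e = cong₂ _+_ (splitSum-cong n (λ i l p → e (suc i) l (cong suc p)))
                                    (splitSum-cong n (λ i l p → e i (suc l) (trans (+-suc i l) (cong suc p))))

splitSum-+ : ∀ n (H G : ℕ → ℕ → ℕ) → splitSum n (λ i l → H i l + G i l) ≡ splitSum n H + splitSum n G
splitSum-+ zero    H G = refl
splitSum-+ (suc n) H G rewrite splitSum-+ n (λ i l → H (suc i) l) (λ i l → G (suc i) l)
                             | splitSum-+ n (λ i l → H i (suc l)) (λ i l → G i (suc l)) =
  +-interchange (splitSum n (λ i l → H (suc i) l)) (splitSum n (λ i l → G (suc i) l))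
                (splitSum n (λ i l → H i (suc l))) (splitSum n (λ i l → G i (suc l)))
  where
  +-interchange : ∀ a b c d → a + b + (c + d) ≡ a + c + (b + d)
  +-interchange = solve-∀

splitSum-* : ∀ n (k : ℕ) (H : ℕ → ℕ → ℕ) → splitSum n (λ i l → k * H i l) ≡ k * splitSum n H
splitSum-* zero    k H = refl
splitSum-* (suc n) k H rewrite splitSum-* n k (λ i l → H (suc i) l) | splitSum-* n k (λ i l → H i (suc l)) =
  sym (*-distribˡ-+ k _ _)

splitSum-ΣL : ∀ {A : Set} (xs : List A) n (H : A → ℕ → ℕ → ℕ) →
              ΣL xs (λ x → splitSum n (H x)) ≡ splitSum n (λ i l → ΣL xs (λ x → H x i l))
splitSum-ΣL []       n H = sym (splitSum-0 n)
  where
  splitSum-0 : ∀ n → splitSum n (λ i l → 0) ≡ 0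
  splitSum-0 zero    = refl
  splitSum-0 (suc n) rewrite splitSum-0 n = refl
splitSum-ΣL (x ∷ xs) n H rewrite splitSum-ΣL xs n H = sym (splitSum-+ n (H x) _)

binomial-theorem : ∀ d n → splitSum n (λ i l → d ^ l) ≡ suc d ^ n
binomial-theorem d zero    = refl
binomial-theorem d (suc n) rewrite binomial-theorem d n | splitSum-* n d (λ i l → d ^ l) | binomial-theorem d n = refl

sumTo : ℕ → (ℕ → ℕ) → ℕ
sumTo zero    g = g 0
sumTo (suc n) g = g 0 + sumTo n (λ i → g (suc i))

sumTo-cong : ∀ n {f g : ℕ → ℕ} → (∀ i → i ≤ n → f i ≡ g i) → sumTo n f ≡ sumTo n g
sumTo-cong zero    e = e 0 z≤n
sumTo-cong (suc n) e = cong₂ _+_ (e 0 z≤n) (sumTo-cong n (λ i p → e (suc i) (s≤s p)))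

sumTo-mono : ∀ n {f g : ℕ → ℕ} → (∀ i → i ≤ n → f i ≤ g i) → sumTo n f ≤ sumTo n g
sumTo-mono zero    e = e 0 z≤n
sumTo-mono (suc n) e = +-mono-≤ (e 0 z≤n) (sumTo-mono n (λ i p → e (suc i) (s≤s p)))

sumTo-+ : ∀ n (f g : ℕ → ℕ) → sumTo n (λ i → f i + g i) ≡ sumTo n f + sumTo n g
sumTo-+ zero    f g = refl
sumTo-+ (suc n) f g rewrite sumTo-+ n (λ i → f (suc i)) (λ i → g (suc i)) =
  +-interchange (f 0) (g 0) (sumTo n (λ i → f (suc i))) (sumTo n (λ i → g (suc i)))
  where
  +-interchange : ∀ a b c d → a + b + (c + d) ≡ a + c + (b + d)
  +-interchange = solve-∀

sumTo-* : ∀ n (k : ℕ) (f : ℕ → ℕ) → sumTo n (λ i → k * f i) ≡ k * sumTo n f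
sumTo-* zero    k f = refl
sumTo-* (suc n) k f rewrite sumTo-* n k (λ i → f (suc i)) = sym (*-distribˡ-+ k _ _)

sumTo-last : ∀ n (g : ℕ → ℕ) → sumTo (suc n) g ≡ sumTo n g + g (suc n)
sumTo-last zero    g = refl
sumTo-last (suc n) g rewrite sumTo-last n (λ i → g (suc i)) = sym (+-assoc (g 0) _ _)

sumTo-extend : ∀ n k (g : ℕ → ℕ) → sumTo n g ≤ sumTo (n + k) g
sumTo-extend n zero    g rewrite +-identityʳ n = ≤-refl
sumTo-extend n (suc k) g rewrite +-suc n k | sumTo-last (n + k) g = ≤-trans (sumTo-extend n k g) (m≤m+n _ _)

splitSum-explicit : ∀ n (H : ℕ → ℕ → ℕ) → splitSum n H ≡ sumTo n (λ i → bin n i * H i (n ∸ i))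
splitSum-explicit zero    H = sym (+-identityʳ (H 0 0))
splitSum-explicit (suc n) H = begin
  splitSum n (λ i l → H (suc i) l) + splitSum n (λ i l → H i (suc l))
    ≡⟨ cong₂ _+_ (splitSum-explicit n _) (splitSum-explicit n _) ⟩
  F + sumTo n (λ i → bin n i * H i (suc (n ∸ i)))
    ≡⟨ cong (F +_) (sumTo-cong n (λ i p → cong (λ t → bin n i * H i t) (sym (+-∸-assoc 1 p)))) ⟩
  F + sumTo n G
    ≡⟨ cong (F +_) G-shift ⟩
  F + (G 0 + sumTo n (λ i → G (suc i)))
    ≡⟨ +-exchange F (G 0) _ ⟩
  G 0 + (F + sumTo n (λ i → G (suc i)))
    ≡⟨ cong₂ _+_ (cong (λ t → t * H 0 (suc n)) (bin-0 n))
                 (trans (sym (sumTo-+ n _ _)) (sumTo-cong n (λ i _ → sym (*-distribʳ-+ (H (suc i) (n ∸ i)) (bin n i) (bin n (suc i)))))) ⟩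
  sumTo (suc n) (λ i → bin (suc n) i * H i (suc n ∸ i)) ∎
  where
  open ≡-Reasoning
  F = sumTo n (λ i → bin n i * H (suc i) (n ∸ i))
  G : ℕ → ℕ
  G i = bin n i * H i (suc n ∸ i)
  -- G vanishes at n+1, so its sum over 0..n can be re-indexed from 1.
  G-shift : sumTo n G ≡ G 0 + sumTo n (λ i → G (suc i))
  G-shift = trans (sym (+-identityʳ _))
    (trans (cong (sumTo n G +_) (sym (cong (λ t → t * H (suc n) (suc n ∸ suc n)) (bin-big n (suc n) (n<1+n n)))))
           (sym (sumTo-last n G)))
  +-exchange : ∀ a b c → a + (b + c) ≡ b + (a + c)
  +-exchange = solve-∀

positions : (d : ℕ) → List (Fin d)
positions zero    = []
positions (suc d) = zero ∷ L.map suc (positions d)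

length-positions : ∀ d → length (positions d) ≡ d
length-positions zero    = refl
length-positions (suc d) = cong suc (trans (length-map suc (positions d)) (length-positions d))

bump : ∀ {d} → Fin d → Vec ℕ d → Vec ℕ d
bump zero    (x ∷ v) = suc x ∷ v
bump (suc j) (x ∷ v) = x ∷ bump j v

profile : ∀ {d n} → Vec (Fin d) n → Vec ℕ d
profile []       = replicate _ 0
profile (j ∷ js) = bump j (profile js)

-- Summing over sequences in [d+1]ⁿ = choosing which entries are the position 0.
ΣV-profile-split : ∀ d n (w : Vec ℕ (suc d) → ℕ) →
  ΣV (positions (suc d)) n (λ js → w (profile js)) ≡
  splitSum n (λ i l → ΣV (positions d) l (λ js → w (i ∷ profile js)))
ΣV-profile-split d zero    w = refl
ΣV-profile-split d (suc n) w = begin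
  ΣV (positions (suc d)) n (λ js → w (bump zero (profile js)))
    + ΣL (L.map suc (positions d)) (λ j → ΣV (positions (suc d)) n (λ js → w (bump j (profile js))))
    ≡⟨ cong₂ _+_ (ΣV-profile-split d n (λ v → w (bump zero v)))
         (trans (ΣL-map suc (positions d) _) (ΣL-cong (positions d) (λ b → ΣV-profile-split d n (λ v → w (bump (suc b) v))))) ⟩
  splitSum n (λ i l → ΣV (positions d) l (λ js → w (suc i ∷ profile js)))
    + ΣL (positions d) (λ b → splitSum n (λ i l → ΣV (positions d) l (λ js → w (i ∷ bump b (profile js)))))
    ≡⟨ cong (splitSum n (λ i l → ΣV (positions d) l (λ js → w (suc i ∷ profile js))) +_) (splitSum-ΣL (positions d) n _) ⟩
  splitSum (suc n) (λ i l → ΣV (positions d) l (λ js → w (i ∷ profile js))) ∎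
  where open ≡-Reasoning

Πv : ∀ {d} → (ℕ → ℕ) → Vec ℕ d → ℕ
Πv g []      = 1
Πv g (x ∷ v) = g x * Πv g v

Πv-sq : ∀ {k} (f : ℕ → ℕ) (v : Vec ℕ k) → Πv f v * Πv f v ≡ Πv (λ x → f x * f x) v
Πv-sq f []      = refl
Πv-sq f (x ∷ v) = trans (interchange (f x) (Πv f v)) (cong (f x * f x *_) (Πv-sq f v))
  where
  interchange : ∀ a b → a * b * (a * b) ≡ a * a * (b * b)
  interchange = solve-∀

profileSum : (ℕ → ℕ) → ℕ → ℕ → ℕ
profileSum g d n = ΣV (positions d) n (λ js → Πv g (profile js))

profileSum-suc : ∀ g d n → profileSum g (suc d) n ≡ splitSum n (λ i l → g i * profileSum g d l)
profileSum-suc g d n = trans (ΣV-profile-split d n (Πv g)) (splitSum-cong n (λ i l _ → ΣV-* (positions d) l (g i) _))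

rising : ℕ → ℕ → ℕ
rising n zero    = 1
rising n (suc d) = rising n d * (n + suc d)

n^d≤rising : ∀ n d → n ^ d ≤ rising n d
n^d≤rising n zero    = ≤-refl
n^d≤rising n (suc d) = ≤-trans (≤-reflexive (*-comm n (n ^ d))) (*-mono-≤ (n^d≤rising n d) (m≤m+n n (suc d)))

rising-absorb : ∀ d i l → bin₂ i l * rising (i + l) (suc d) ≡ bin₂ (suc i) (l + d) * suc i * rising l d
rising-absorb zero    i l = trans (cong (bin₂ i l *_) (*-identityˡ (i + l + 1)))
  (trans (bin₂-absorb i l) (trans (cong (λ t → bin₂ (suc i) t * suc i) (sym (+-identityʳ l))) (sym (*-identityʳ _))))
rising-absorb (suc d) i l = begin
  bin₂ i l * (rising (i + l) (suc d) * (i + l + suc (suc d)))     ≡⟨ sym (*-assoc (bin₂ i l) _ _) ⟩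
  bin₂ i l * rising (i + l) (suc d) * (i + l + suc (suc d))       ≡⟨ cong (_* (i + l + suc (suc d))) (rising-absorb d i l) ⟩
  B * suc i * rising l d * (i + l + suc (suc d))                 ≡⟨ regroup B (suc i) (rising l d) _ ⟩
  (B * (i + l + suc (suc d))) * suc i * rising l d               ≡⟨ cong (λ t → t * suc i * rising l d) absorbed ⟩
  (bin₂ (suc i) (suc (l + d)) * suc (l + d)) * suc i * rising l d ≡⟨ cong (λ t → bin₂ (suc i) t * t * suc i * rising l d) (sym (+-suc l d)) ⟩
  (bin₂ (suc i) (l + suc d) * (l + suc d)) * suc i * rising l d   ≡⟨ regroup′ (bin₂ (suc i) (l + suc d)) (l + suc d) (suc i) (rising l d) ⟩
  bin₂ (suc i) (l + suc d) * suc i * (rising l d * (l + suc d))   ∎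
  where
  open ≡-Reasoning
  B = bin₂ (suc i) (l + d)
  absorbed : B * (i + l + suc (suc d)) ≡ bin₂ (suc i) (suc (l + d)) * suc (l + d)
  absorbed = trans (cong (B *_) (arith i l d))
                   (trans (bin₂-absorb (suc i) (l + d)) (sym (bin₂-shift (suc i) (l + d))))
    where
    arith : ∀ i l d → i + l + suc (suc d) ≡ suc i + (l + d) + 1
    arith = solve-∀
  regroup : ∀ a b c x → a * b * c * x ≡ (a * x) * b * c
  regroup = solve-∀
  regroup′ : ∀ a x b c → (a * x) * b * c ≡ a * b * (c * x)
  regroup′ = solve-∀

-- Induction on d: split off the position 0, used i times (splitSum), absorb the rising
-- factorial into the binomial coefficient (rising-absorb), and sum the resulting
-- binomial coefficients C(n+d+1, i+1) d^(n+d-i) by the binomial theorem.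
module ProfileSumBound (g : ℕ → ℕ) (c : ℕ) (g-bound : ∀ N → g N * suc N ≤ c * 4 ^ N) where

  split-term-bound : ∀ d → (∀ l → profileSum g d l * rising l d ≤ c ^ d * 4 ^ l * d ^ (l + d)) →
    ∀ i l → bin (i + l) i * (g i * profileSum g d l) * rising (i + l) (suc d) ≤
            c ^ suc d * 4 ^ (i + l) * (bin (i + l + suc d) (suc i) * d ^ ((i + l + suc d) ∸ suc i))
  split-term-bound d IH i l = begin
    bin (i + l) i * (g i * S) * rising (i + l) (suc d)  ≡⟨ regroup (bin (i + l) i) (g i) S (rising (i + l) (suc d)) ⟩
    (bin (i + l) i * rising (i + l) (suc d)) * (g i * S) ≡⟨ cong (λ t → (t * rising (i + l) (suc d)) * (g i * S)) (bin≡bin₂ i l) ⟩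
    (bin₂ i l * rising (i + l) (suc d)) * (g i * S)      ≡⟨ cong (_* (g i * S)) (rising-absorb d i l) ⟩
    (B * suc i * rising l d) * (g i * S)                ≡⟨ regroup′ B (suc i) (rising l d) (g i) S ⟩
    B * ((g i * suc i) * (S * rising l d))              ≤⟨ *-monoʳ-≤ B (*-mono-≤ (g-bound i) (IH l)) ⟩
    B * ((c * 4 ^ i) * (c ^ d * 4 ^ l * d ^ (l + d)))   ≡⟨ regroup″ B c (4 ^ i) (c ^ d) (4 ^ l) (d ^ (l + d)) ⟩
    c ^ suc d * (4 ^ i * 4 ^ l) * (B * d ^ (l + d))     ≡⟨ cong₂ (λ u v → c ^ suc d * u * v) (sym (^-distribˡ-+-* 4 i l)) (cong₂ _*_ B≡bin exponent) ⟩
    c ^ suc d * 4 ^ (i + l) * (bin (i + l + suc d) (suc i) * d ^ ((i + l + suc d) ∸ suc i)) ∎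
    where
    open ≤-Reasoning
    S = profileSum g d l
    B = bin₂ (suc i) (l + d)
    total : ∀ i l d → suc i + (l + d) ≡ i + l + suc d
    total = solve-∀
    B≡bin : B ≡ bin (i + l + suc d) (suc i)
    B≡bin = trans (sym (bin≡bin₂ (suc i) (l + d))) (cong (λ t → bin t (suc i)) (total i l d))
    exponent : d ^ (l + d) ≡ d ^ ((i + l + suc d) ∸ suc i)
    exponent = cong (d ^_) (trans (sym (m+n∸m≡n (suc i) (l + d))) (cong (_∸ suc i) (total i l d)))
    regroup : ∀ b x y R → b * (x * y) * R ≡ (b * R) * (x * y)
    regroup = solve-∀
    regroup′ : ∀ B si Rl gi Al → (B * si * Rl) * (gi * Al) ≡ B * ((gi * si) * (Al * Rl))
    regroup′ = solve-∀
    regroup″ : ∀ B c c4i cd p4l dp → B * ((c * c4i) * (cd * p4l * dp)) ≡ c * cd * (c4i * p4l) * (B * dp)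
    regroup″ = solve-∀

  profileSum-bound : ∀ d n → profileSum g d n * rising n d ≤ c ^ d * 4 ^ n * d ^ (n + d)
  profileSum-bound zero    zero    = ≤-refl
  profileSum-bound zero    (suc n) = z≤n
  profileSum-bound (suc d) n = begin
    profileSum g (suc d) n * R                              ≡⟨ cong (_* R) (trans (profileSum-suc g d n) (splitSum-explicit n _)) ⟩
    sumTo n (λ i → bin n i * (g i * profileSum g d (n ∸ i))) * R ≡⟨ trans (*-comm _ R) (sym (sumTo-* n R _)) ⟩
    sumTo n (λ i → R * (bin n i * (g i * profileSum g d (n ∸ i)))) ≤⟨ sumTo-mono n (λ i i≤n → ≤-trans (≤-reflexive (*-comm R _)) (term i i≤n)) ⟩
    sumTo n (λ i → K * G (suc i))                           ≡⟨ sumTo-* n K _ ⟩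
    K * sumTo n (λ i → G (suc i))                           ≤⟨ *-monoʳ-≤ K (≤-trans (m≤n+m _ (G 0)) (≤-trans (sumTo-extend (suc n) d G) (≤-reflexive (cong (λ t → sumTo t G) (sym (+-suc n d)))))) ⟩
    K * sumTo (n + suc d) G                                 ≡⟨ cong (K *_) (trans (sym (splitSum-explicit (n + suc d) (λ i l → d ^ l))) (binomial-theorem d (n + suc d))) ⟩
    K * suc d ^ (n + suc d)                                 ∎
    where
    open ≤-Reasoning
    R = rising n (suc d)
    K = c ^ suc d * 4 ^ n
    G : ℕ → ℕ
    G j = bin (n + suc d) j * d ^ ((n + suc d) ∸ j)
    term : ∀ i → i ≤ n → bin n i * (g i * profileSum g d (n ∸ i)) * R ≤ K * G (suc i)
    term i i≤n = subst (λ t → bin t i * (g i * profileSum g d (n ∸ i)) * rising t (suc d) ≤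
                              c ^ suc d * 4 ^ t * (bin (t + suc d) (suc i) * d ^ ((t + suc d) ∸ suc i)))
                       (m+[n∸m]≡n i≤n) (split-term-bound d (profileSum-bound d) i (n ∸ i))

open ProfileSumBound using (profileSum-bound)

-- Balanced columns and their encoding by (first entry, marked position, balanced word).

same : Bool → Bool → Bool
same true  true  = true
same false false = true
same true  false = false
same false true  = false

count : ∀ {L} → Bool → Vec Bool L → ℕ
count x []      = 0
count x (y ∷ v) = ind (same y x) + count x v

lineSum+count-false : ∀ {L} (c : Vec Bool L) → lineSum c Z.+ +ᶻ count false c ≡ +ᶻ count true c
lineSum+count-false []          = refl
lineSum+count-false (true ∷ c)  = trans (ZP.+-assoc (+ᶻ 1) (lineSum c) _) (cong (λ t → +ᶻ 1 Z.+ t) (lineSum+count-false c))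
lineSum+count-false (false ∷ c) = trans (cancel (lineSum c) (+ᶻ count false c)) (lineSum+count-false c)
  where
  cancel : ∀ x y → (Z.- (+ᶻ 1) Z.+ x) Z.+ (+ᶻ 1 Z.+ y) ≡ x Z.+ y
  cancel = ZR.solve-∀

count-total : ∀ {L} (c : Vec Bool L) → count true c + count false c ≡ L
count-total []          = refl
count-total (true ∷ c)  = cong suc (count-total c)
count-total (false ∷ c) = trans (+-suc (count true c) (count false c)) (cong suc (count-total c))

-- A column of even length 2(p+1) with sum in [-1, 1] has exactly p+1 entries +1:
-- the sum has the parity of the length, so it is 0.
balanced-column : ∀ p (c : Vec Bool (suc (suc (p + p)))) → smallSum c ≡ true → count true c ≡ suc p
balanced-column p c small-c =
  from-counts (lineSum c) (count true c) (count false c) (lineSum+count-false c) (count-total c) small-c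
  where
  twice : ∀ a → a + a ≡ 2 * a
  twice = solve-∀
  length-c : suc (suc (p + p)) ≡ 2 * suc p
  length-c = trans (cong suc (sym (+-suc p p))) (twice (suc p))
  from-counts : ∀ z t f → z Z.+ +ᶻ f ≡ +ᶻ t → t + f ≡ suc (suc (p + p)) → (∣ z ∣ ≤ᵇ 1) ≡ true → t ≡ suc p
  from-counts (+ᶻ zero)          t f       e s _ with ZP.+-injective e
  ... | refl = *-cancelˡ-≡ f (suc p) 2 (trans (sym (twice f)) (trans s length-c))
  from-counts (+ᶻ suc zero)      t f       e s _ with ZP.+-injective e
  ... | refl = ⊥-elim (even≢odd (suc p) f (sym (trans (cong suc (sym (twice f))) (trans s length-c))))
  from-counts (+ᶻ suc (suc n))   t f       e s ()
  from-counts -[1+ zero ]        t zero    () s _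
  from-counts -[1+ zero ]        t (suc f) e s _ with ZP.+-injective e
  ... | refl = ⊥-elim (even≢odd (suc p) t (sym (trans (cong suc (sym (twice t))) (trans (sym (+-suc t t)) (trans s length-c)))))
  from-counts -[1+ suc n ]       t f       e s ()

balanced-opposite : ∀ p ε (u : Vec Bool (suc (p + p))) → count true (ε ∷ u) ≡ suc p → count (not ε) u ≡ suc p
balanced-opposite p true  u e = +-cancelˡ-≡ p _ _ (trans (cong (_+ count false u) (sym (suc-injective e)))
                                                         (trans (count-total u) (sym (+-suc p p))))
balanced-opposite p false u e = e

count-positions : ∀ {L} (u : Vec Bool L) x → ΣL (positions L) (λ j → ind (same (lookup u j) x)) ≡ count x u
count-positions []                x = refl
count-positions {suc L} (y ∷ u) x =
  cong (ind (same y x) +_) (trans (ΣL-map suc (positions L) (λ j → ind (same (lookup (y ∷ u) j) x))) (count-positions u x))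

count-insert : ∀ {L} x y (w : Vec Bool L) (j : Fin (suc L)) → count x (insertAt w j y) ≡ ind (same y x) + count x w
count-insert x y w       zero    = refl
count-insert x y (z ∷ w) (suc j) rewrite count-insert x y w j = +-exchange (ind (same z x)) (ind (same y x)) _
  where
  +-exchange : ∀ a b c → a + (b + c) ≡ b + (a + c)
  +-exchange = solve-∀

count-encoded : ∀ {L} ε (w : Vec Bool L) j → count true (ε ∷ insertAt w j (not ε)) ≡ suc (count true w)
count-encoded true  w j rewrite count-insert true false w j = refl
count-encoded false w j rewrite count-insert true true  w j = refl

select : ∀ x (F : Bool → ℕ) → ΣL signs (λ y → ind (same y x) * F y) ≡ F x
select true  F = trans (+-identityʳ _) (+-identityʳ _)
select false F = trans (+-identityʳ _) (+-identityʳ _)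

mutual
  ΣV-marked-position : ∀ L (x : Bool) (H : Vec Bool (suc L) → Fin (suc L) → ℕ) →
    ΣV signs (suc L) (λ u → ΣL (positions (suc L)) (λ j → ind (same (lookup u j) x) * H u j)) ≡
    ΣL (positions (suc L)) (λ j → ΣV signs L (λ w → H (insertAt w j x) j))
  ΣV-marked-position L x H = begin
    ΣL signs (λ y → ΣV signs L (λ u → Head y u + Tail y u))
      ≡⟨ ΣL-cong signs (λ y → ΣV-+ signs L (Head y) (Tail y)) ⟩
    ΣL signs (λ y → ΣV signs L (Head y) + ΣV signs L (Tail y))
      ≡⟨ ΣL-+ signs (λ y → ΣV signs L (Head y)) (λ y → ΣV signs L (Tail y)) ⟩
    ΣL signs (λ y → ΣV signs L (Head y)) + ΣL signs (λ y → ΣV signs L (Tail y))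
      ≡⟨ cong₂ _+_ (trans (ΣL-cong signs (λ y → ΣV-* signs L (ind (same y x)) (λ u → H (y ∷ u) zero)))
                          (select x (λ y → ΣV signs L (λ u → H (y ∷ u) zero))))
                   (marked-in-tail L x H) ⟩
    ΣV signs L (λ w → H (x ∷ w) zero) + ΣL (L.map suc (positions L)) (λ j → ΣV signs L (λ w → H (insertAt w j x) j)) ∎
    where
    open ≡-Reasoning
    Head Tail : Bool → Vec Bool L → ℕ
    Head y u = ind (same y x) * H (y ∷ u) zero
    Tail y u = ΣL (L.map suc (positions L)) (λ j → ind (same (lookup (y ∷ u) j) x) * H (y ∷ u) j)

  marked-in-tail : ∀ L (x : Bool) (H : Vec Bool (suc L) → Fin (suc L) → ℕ) →
    ΣL signs (λ y → ΣV signs L (λ u → ΣL (L.map suc (positions L)) (λ j → ind (same (lookup (y ∷ u) j) x) * H (y ∷ u) j))) ≡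
    ΣL (L.map suc (positions L)) (λ j → ΣV signs L (λ w → H (insertAt w j x) j))
  marked-in-tail zero    x H = refl
  marked-in-tail (suc L) x H = begin
    ΣL signs (λ y → ΣV signs (suc L) (λ u → ΣL (L.map suc (positions (suc L))) (λ j → ind (same (lookup (y ∷ u) j) x) * H (y ∷ u) j)))
      ≡⟨ ΣL-cong signs (λ y → ΣV-cong signs (suc L) (λ u → ΣL-map suc (positions (suc L)) (λ j → ind (same (lookup (y ∷ u) j) x) * H (y ∷ u) j))) ⟩
    ΣL signs (λ y → ΣV signs (suc L) (λ u → ΣL (positions (suc L)) (λ j → ind (same (lookup u j) x) * H (y ∷ u) (suc j))))
      ≡⟨ ΣL-cong signs (λ y → ΣV-marked-position L x (λ u j → H (y ∷ u) (suc j))) ⟩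
    ΣL signs (λ y → ΣL (positions (suc L)) (λ j → ΣV signs L (λ w → H (y ∷ insertAt w j x) (suc j))))
      ≡⟨ ΣL-swap signs (positions (suc L)) (λ y j → ΣV signs L (λ w → H (y ∷ insertAt w j x) (suc j))) ⟩
    ΣL (positions (suc L)) (λ j → ΣV signs (suc L) (λ w → H (insertAt w (suc j) x) (suc j)))
      ≡⟨ sym (ΣL-map suc (positions (suc L)) (λ j → ΣV signs (suc L) (λ w → H (insertAt w j x) j))) ⟩
    ΣL (L.map suc (positions (suc L))) (λ j → ΣV signs (suc L) (λ w → H (insertAt w j x) j)) ∎
    where open ≡-Reasoning

balanced : ℕ → ∀ {L} → Vec Bool L → Bool
balanced p w = count true w ≡ᵇ p

balancedWords : (p : ℕ) → List (Vec Bool (p + p))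
balancedWords p = filterᵇ (balanced p) (allVecs signs (p + p))

ΣV-count≡bin : ∀ L i → ΣV signs L (λ w → ind (count true w ≡ᵇ i)) ≡ bin L i
ΣV-count≡bin zero    zero    = refl
ΣV-count≡bin zero    (suc i) = refl
ΣV-count≡bin (suc L) zero    =
  trans (cong (λ x → x + (ΣV signs L (λ w → ind (count true w ≡ᵇ 0)) + 0)) (trans (ΣV-const signs L 0) (*-zeroʳ (length signs ^ L))))
        (trans (+-identityʳ _) (trans (ΣV-count≡bin L 0) (bin-0 L)))
ΣV-count≡bin (suc L) (suc i) = cong₂ _+_ (ΣV-count≡bin L i) (trans (+-identityʳ _) (ΣV-count≡bin L (suc i)))

length-balancedWords : ∀ p → length (balancedWords p) ≡ bin₂ p p
length-balancedWords p = begin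
  length (balancedWords p)                                    ≡⟨ length-filter (balanced p) (allVecs signs (p + p)) ⟩
  ΣL (allVecs signs (p + p)) (λ w → ind (balanced p w))       ≡⟨ ΣL-allVecs signs (p + p) (λ w → ind (balanced p w)) ⟩
  ΣV signs (p + p) (λ w → ind (balanced p w))                 ≡⟨ ΣV-count≡bin (p + p) p ⟩
  bin (p + p) p                                               ≡⟨ bin≡bin₂ p p ⟩
  bin₂ p p                                                    ∎
  where open ≡-Reasoning

≡ᵇ-refl : ∀ n → (n ≡ᵇ n) ≡ true
≡ᵇ-refl zero    = refl
≡ᵇ-refl (suc n) = ≡ᵇ-refl n

-- A small column ε ∷ u of length 2(p+1) has p+1 positions j with u_j = ¬ε, so the weight
-- (p+1) X is the sum of X over these positions.
small-column-multiplicity : ∀ p ε (u : Vec Bool (suc (p + p))) X →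
  ind (smallSum (ε ∷ u)) * (suc p * X) ≤
  ΣL (positions (suc (p + p))) (λ j → ind (same (lookup u j) (not ε)) * (ind (smallSum (ε ∷ u)) * X))
small-column-multiplicity p ε u X with smallSum (ε ∷ u) in small-c
... | false = z≤n
... | true  = ≤-reflexive (begin
  1 * (suc p * X)                          ≡⟨ reorder (suc p) X ⟩
  (1 * X) * suc p                          ≡⟨ cong ((1 * X) *_) (sym (trans (count-positions u (not ε))
                                                 (balanced-opposite p ε u (balanced-column p (ε ∷ u) small-c)))) ⟩
  (1 * X) * ΣL (positions d) (λ j → ind (same (lookup u j) (not ε))) ≡⟨ sym (ΣL-* (positions d) (1 * X) _) ⟩
  ΣL (positions d) (λ j → (1 * X) * ind (same (lookup u j) (not ε))) ≡⟨ ΣL-cong (positions d) (λ j → *-comm (1 * X) _) ⟩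
  ΣL (positions d) (λ j → ind (same (lookup u j) (not ε)) * (1 * X)) ∎)
  where
  open ≡-Reasoning
  d = suc (p + p)
  reorder : ∀ a x → 1 * (a * x) ≡ (1 * x) * a
  reorder = solve-∀

encoded-small⇒balanced : ∀ p ε j (w : Vec Bool (p + p)) X →
  ind (smallSum (ε ∷ insertAt w j (not ε))) * X ≤ ind (balanced p w) * X
encoded-small⇒balanced p ε j w X with smallSum (ε ∷ insertAt w j (not ε)) in small-c
... | false = z≤n
... | true rewrite suc-injective (trans (sym (count-encoded ε w j)) (balanced-column p (ε ∷ insertAt w j (not ε)) small-c))
                 | ≡ᵇ-refl p = ≤-refl

-- The encoding of small columns of length 2(p+1): every such column ε ∷ u arises from
-- exactly p+1 triples (ε, j, w), one for each position j where u carries ¬ε, and the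
-- remaining word w is balanced.
column-encoding : ∀ p (G : Vec Bool (suc (suc (p + p))) → ℕ) →
  ΣV signs (suc (suc (p + p))) (λ c → ind (smallSum c) * (suc p * G c)) ≤
  ΣL (positions (suc (p + p))) (λ j → ΣL (balancedWords p) (λ w → ΣL signs (λ ε → G (ε ∷ insertAt w j (not ε)))))
column-encoding p G = begin
  ΣL signs (λ ε → ΣV signs d (λ u → ind (smallSum (ε ∷ u)) * (suc p * G (ε ∷ u))))
    ≤⟨ ΣL-mono signs (λ ε → ΣV-mono signs d (λ u → small-column-multiplicity p ε u (G (ε ∷ u)))) ⟩
  ΣL signs (λ ε → ΣV signs d (λ u → ΣL (positions d) (λ j → ind (same (lookup u j) (not ε)) * (ind (smallSum (ε ∷ u)) * G (ε ∷ u)))))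
    ≡⟨ ΣL-cong signs (λ ε → ΣV-marked-position (p + p) (not ε) (λ u j → ind (smallSum (ε ∷ u)) * G (ε ∷ u))) ⟩
  ΣL signs (λ ε → ΣL (positions d) (λ j → ΣV signs (p + p) (λ w → ind (smallSum (E ε j w)) * G (E ε j w))))
    ≤⟨ ΣL-mono signs (λ ε → ΣL-mono (positions d) (λ j → ΣV-mono signs (p + p) (λ w → encoded-small⇒balanced p ε j w (G (E ε j w))))) ⟩
  ΣL signs (λ ε → ΣL (positions d) (λ j → ΣV signs (p + p) (λ w → ind (balanced p w) * G (E ε j w))))
    ≡⟨ ΣL-cong signs (λ ε → ΣL-cong (positions d) (λ j → sym (trans (ΣL-filter (balanced p) (allVecs signs (p + p)) (λ w → G (E ε j w)))
                                                                     (ΣL-allVecs signs (p + p) (λ w → ind (balanced p w) * G (E ε j w)))))) ⟩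
  ΣL signs (λ ε → ΣL (positions d) (λ j → ΣL (balancedWords p) (λ w → G (E ε j w))))
    ≡⟨ trans (ΣL-swap signs (positions d) (λ ε j → ΣL (balancedWords p) (λ w → G (E ε j w))))
             (ΣL-cong (positions d) (λ j → ΣL-swap signs (balancedWords p) (λ ε w → G (E ε j w)))) ⟩
  ΣL (positions d) (λ j → ΣL (balancedWords p) (λ w → ΣL signs (λ ε → G (E ε j w)))) ∎
  where
  open ≤-Reasoning
  d = suc (p + p)
  E : Bool → Fin d → Vec Bool (p + p) → Vec Bool (suc d)
  E ε j w = ε ∷ insertAt w j (not ε)

-- Counting sign patterns row by row.

binHalf : ℕ → ℤ → ℕ
binHalf L (+ᶻ n)    = bin L ⌊ n /2⌋
binHalf L -[1+ n ] = 0

binHalf-step : ∀ L z → binHalf L z + binHalf L (z Z.+ +ᶻ 2) ≡ binHalf (suc L) (z Z.+ +ᶻ 2)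
binHalf-step L (+ᶻ n) rewrite +-comm n 2 = refl
binHalf-step L -[1+ zero ]          = bin-0 L
binHalf-step L -[1+ suc zero ]      = bin-0 L
binHalf-step L -[1+ suc (suc n) ]   = refl

-- rowWays N y = C(N+1, (N+1+y)/2) bounds the number of choices of N free signs that
-- keep a row with offset y (see rowOffset) small: it dominates that count for N = 0
-- and satisfies the same recursion in N.
rowWays : ℕ → ℤ → ℕ
rowWays N y = binHalf (suc N) (+ᶻ suc N Z.+ y)

rowWays-step : ∀ N u → rowWays N u + rowWays N (u Z.+ +ᶻ 2) ≡ rowWays (suc N) (+ᶻ 1 Z.+ u)
rowWays-step N u = trans (cong (λ t → rowWays N u + binHalf (suc N) t) (reassoc (+ᶻ suc N) u))
  (trans (binHalf-step (suc N) (+ᶻ suc N Z.+ u)) (cong (binHalf (suc (suc N))) (shift (+ᶻ suc N) u)))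
  where
  reassoc : ∀ a u → a Z.+ (u Z.+ +ᶻ 2) ≡ (a Z.+ u) Z.+ +ᶻ 2
  reassoc = ZR.solve-∀
  shift : ∀ a u → (a Z.+ u) Z.+ +ᶻ 2 ≡ (+ᶻ 1 Z.+ a) Z.+ (+ᶻ 1 Z.+ u)
  shift = ZR.solve-∀

rowWays-base : ∀ y → ind (small y) ≤ rowWays 0 y
rowWays-base (+ᶻ zero)          = ≤-refl
rowWays-base (+ᶻ suc zero)      = ≤-refl
rowWays-base (+ᶻ suc (suc n))   = z≤n
rowWays-base -[1+ zero ]       = ≤-refl
rowWays-base -[1+ suc n ]      = z≤n

rowWays≤maxBin : ∀ N y → rowWays N y ≤ maxBin (suc N)
rowWays≤maxBin N y with +ᶻ suc N Z.+ y
... | +ᶻ n      = bin≤maxBin (suc N) ⌊ n /2⌋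
... | -[1+ n ] = z≤n

sameFin : ∀ {d} → Fin d → Fin d → Bool
sameFin zero    zero    = true
sameFin zero    (suc _) = false
sameFin (suc _) zero    = false
sameFin (suc a) (suc b) = sameFin a b

sameFin-refl : ∀ {d} (j : Fin d) → sameFin j j ≡ true
sameFin-refl zero    = refl
sameFin-refl (suc j) = sameFin-refl j

ΠF : (d : ℕ) → (Fin d → ℕ) → ℕ
ΠF zero    g = 1
ΠF (suc d) g = g zero * ΠF d (λ b → g (suc b))

ΠF-cong : ∀ d {f g : Fin d → ℕ} → (∀ b → f b ≡ g b) → ΠF d f ≡ ΠF d g
ΠF-cong zero    e = refl
ΠF-cong (suc d) e = cong₂ _*_ (e zero) (ΠF-cong d (λ b → e (suc b)))

ΠF-mono : ∀ d {f g : Fin d → ℕ} → (∀ b → f b ≤ g b) → ΠF d f ≤ ΠF d g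
ΠF-mono zero    e = ≤-refl
ΠF-mono (suc d) e = *-mono-≤ (e zero) (ΠF-mono d (λ b → e (suc b)))

ΠF-lookup : ∀ {d} (g : ℕ → ℕ) (v : Vec ℕ d) → ΠF d (λ b → g (lookup v b)) ≡ Πv g v
ΠF-lookup g []      = refl
ΠF-lookup g (x ∷ v) = cong (g x *_) (ΠF-lookup g v)

ΠF-split : ∀ d (j : Fin d) (P Q R : Fin d → ℕ) →
  (∀ b → sameFin b j ≡ false → P b ≡ R b) → (∀ b → sameFin b j ≡ false → Q b ≡ R b) →
  P j + Q j ≡ R j → ΠF d P + ΠF d Q ≡ ΠF d R
ΠF-split (suc d) zero P Q R hP hQ hj =
  trans (cong₂ (λ x y → P zero * x + Q zero * y) (ΠF-cong d (λ b → hP (suc b) refl)) (ΠF-cong d (λ b → hQ (suc b) refl)))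
        (trans (sym (*-distribʳ-+ _ (P zero) (Q zero))) (cong (_* ΠF d (λ b → R (suc b))) hj))
ΠF-split (suc d) (suc j) P Q R hP hQ hj =
  trans (cong₂ (λ x y → x * ΠF d (λ b → P (suc b)) + y * ΠF d (λ b → Q (suc b))) (hP zero refl) (hQ zero refl))
        (trans (sym (*-distribˡ-+ (R zero) _ _))
               (cong (R zero *_) (ΠF-split d j (λ b → P (suc b)) (λ b → Q (suc b)) (λ b → R (suc b))
                                           (λ b → hP (suc b)) (λ b → hQ (suc b)) hj)))

lookup-bump-≡ : ∀ {d} (j : Fin d) (v : Vec ℕ d) → lookup (bump j v) j ≡ suc (lookup v j)
lookup-bump-≡ zero    (x ∷ v) = refl
lookup-bump-≡ (suc j) (x ∷ v) = lookup-bump-≡ j v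

lookup-bump-≢ : ∀ {d} (j b : Fin d) (v : Vec ℕ d) → sameFin b j ≡ false → lookup (bump j v) b ≡ lookup v b
lookup-bump-≢ zero    zero    v       ()
lookup-bump-≢ zero    (suc b) (x ∷ v) e = refl
lookup-bump-≢ (suc j) zero    (x ∷ v) e = refl
lookup-bump-≢ (suc j) (suc b) (x ∷ v) e = lookup-bump-≢ j b v e

lookup-⊕ : ∀ {d} (t : Vec ℤ d) (v : Vec Bool d) b → lookup (t ⊕ v) b ≡ lookup t b Z.+ entry (lookup v b)
lookup-⊕ t v b = lookup-zipWith (λ z x → z Z.+ entry x) b t v

δ₁ δ₂ : ∀ {d} → Fin d → Fin d → ℤ
δ₁ b j = if sameFin b j then +ᶻ 1 else +ᶻ 0
δ₂ b j = if sameFin b j then +ᶻ 2 else +ᶻ 0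

insert-true-false : ∀ {L} (w : Vec Bool L) (j b : Fin (suc L)) →
  entry (lookup (insertAt w j true) b) ≡ entry (lookup (insertAt w j false) b) Z.+ δ₂ b j
insert-true-false w       zero    zero    = refl
insert-true-false w       zero    (suc b) = sym (ZP.+-identityʳ _)
insert-true-false (y ∷ w) (suc j) zero    = sym (ZP.+-identityʳ _)
insert-true-false (y ∷ w) (suc j) (suc b) = insert-true-false w j b

-- signPatterns t js ws: the number of sign sequences ε such that the columns
-- (ε_k, w_k with ¬ε_k inserted at j_k), restricted to rows 1..d, bring the partial
-- row sums t to small values.
signPatterns : ∀ {L n} → Vec ℤ (suc L) → Vec (Fin (suc L)) n → Vec (Vec Bool L) n → ℕ
signPatterns t []       []       = ind (allSmall t)
signPatterns t (j ∷ js) (w ∷ ws) = ΣL signs (λ ε → signPatterns (t ⊕ insertAt w j (not ε)) js ws)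

-- The final sum of row b when all its free entries (those of the columns marked at b)
-- are -1, plus their number k_b; row b ends small iff offset - k_b + (free entries) is small.
rowOffset : ∀ {L n} → Fin (suc L) → Vec ℤ (suc L) → Vec (Fin (suc L)) n → Vec (Vec Bool L) n → ℤ
rowOffset b t []       []       = lookup t b
rowOffset b t (j ∷ js) (w ∷ ws) = δ₁ b j Z.+ rowOffset b (t ⊕ insertAt w j false) js ws

rowOffset-shift : ∀ {L n} (js : Vec (Fin (suc L)) n) (ws : Vec (Vec Bool L) n) (t t′ : Vec ℤ (suc L)) (D : Fin (suc L) → ℤ) →
  (∀ b → lookup t′ b ≡ lookup t b Z.+ D b) → ∀ b → rowOffset b t′ js ws ≡ rowOffset b t js ws Z.+ D b
rowOffset-shift []       []       t t′ D h b = h b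
rowOffset-shift (j ∷ js) (w ∷ ws) t t′ D h b =
  trans (cong (λ x → δ₁ b j Z.+ x) (rowOffset-shift js ws (t ⊕ insertAt w j false) (t′ ⊕ insertAt w j false) D h′ b))
        (sym (ZP.+-assoc (δ₁ b j) _ (D b)))
  where
  swap : ∀ a d x → (a Z.+ d) Z.+ x ≡ (a Z.+ x) Z.+ d
  swap = ZR.solve-∀
  h′ : ∀ b → lookup (t′ ⊕ insertAt w j false) b ≡ lookup (t ⊕ insertAt w j false) b Z.+ D b
  h′ b = trans (lookup-⊕ t′ _ b) (trans (cong (Z._+ entry (lookup (insertAt w j false) b)) (h b))
              (trans (swap (lookup t b) (D b) _) (cong (Z._+ D b) (sym (lookup-⊕ t _ b)))))

allSmall≤ΠrowWays : ∀ {d} (t : Vec ℤ d) → ind (allSmall t) ≤ ΠF d (λ b → rowWays 0 (lookup t b))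
allSmall≤ΠrowWays []      = ≤-refl
allSmall≤ΠrowWays (z ∷ t) = ≤-trans (≤-reflexive (ind-∧ (small z) (allSmall t))) (*-mono-≤ (rowWays-base z) (allSmall≤ΠrowWays t))

-- The rows constrain the free signs independently: signPatterns ≤ Π_b rowWays(k_b, offset_b).
signPatterns≤ΠrowWays : ∀ {L n} (js : Vec (Fin (suc L)) n) (ws : Vec (Vec Bool L) n) (t : Vec ℤ (suc L)) →
  signPatterns t js ws ≤ ΠF (suc L) (λ b → rowWays (lookup (profile js) b) (rowOffset b t js ws))
signPatterns≤ΠrowWays {L} []       []       t =
  ≤-trans (allSmall≤ΠrowWays t) (≤-reflexive (ΠF-cong (suc L) (λ b → cong (λ x → rowWays x (lookup t b)) (sym (lookup-replicate b 0)))))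
signPatterns≤ΠrowWays {L} (j ∷ js) (w ∷ ws) t = begin
  signPatterns tF js ws + (signPatterns tT js ws + 0) ≡⟨ cong (signPatterns tF js ws +_) (+-identityʳ (signPatterns tT js ws)) ⟩
  signPatterns tF js ws + signPatterns tT js ws       ≤⟨ +-mono-≤ (signPatterns≤ΠrowWays js ws tF) (signPatterns≤ΠrowWays js ws tT) ⟩
  ΠF (suc L) P + ΠF (suc L) Q                         ≡⟨ ΠF-split (suc L) j P Q R P≡R Q≡R P+Q≡R ⟩
  ΠF (suc L) R                                        ∎
  where
  open ≤-Reasoning
  tF = t ⊕ insertAt w j false
  tT = t ⊕ insertAt w j true
  u : Fin (suc L) → ℤ
  u b = rowOffset b tF js ws
  P Q R : Fin (suc L) → ℕ
  P b = rowWays (lookup (profile js) b) (u b)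
  Q b = rowWays (lookup (profile js) b) (rowOffset b tT js ws)
  R b = rowWays (lookup (bump j (profile js)) b) (δ₁ b j Z.+ u b)
  uT : ∀ b → rowOffset b tT js ws ≡ u b Z.+ δ₂ b j
  uT = rowOffset-shift js ws tF tT (λ b → δ₂ b j)
         (λ b → trans (lookup-⊕ t _ b) (trans (cong (λ x → lookup t b Z.+ x) (insert-true-false w j b))
                (trans (sym (ZP.+-assoc (lookup t b) _ _)) (cong (Z._+ δ₂ b j) (sym (lookup-⊕ t _ b))))))
  P≡R : ∀ b → sameFin b j ≡ false → P b ≡ R b
  P≡R b e rewrite e = cong₂ rowWays (sym (lookup-bump-≢ j b (profile js) e)) (sym (ZP.+-identityˡ (u b)))
  Q≡R : ∀ b → sameFin b j ≡ false → Q b ≡ R b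
  Q≡R b e rewrite uT b | e = cong₂ rowWays (sym (lookup-bump-≢ j b (profile js) e)) (trans (ZP.+-identityʳ (u b)) (sym (ZP.+-identityˡ (u b))))
  P+Q≡R : P j + Q j ≡ R j
  P+Q≡R rewrite uT j | sameFin-refl j | lookup-bump-≡ j (profile js) = rowWays-step (lookup (profile js) j) (u j)

rowBound : ℕ → ℕ
rowBound N = maxBin (suc N)

signPatterns≤Π : ∀ {L n} (js : Vec (Fin (suc L)) n) (ws : Vec (Vec Bool L) n) (t : Vec ℤ (suc L)) →
  signPatterns t js ws ≤ Πv rowBound (profile js)
signPatterns≤Π {L} js ws t =
  ≤-trans (signPatterns≤ΠrowWays js ws t)
          (≤-trans (ΠF-mono (suc L) (λ b → rowWays≤maxBin (lookup (profile js) b) (rowOffset b t js ws)))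
                   (≤-reflexive (ΠF-lookup rowBound (profile js))))

*-^-distrib : ∀ a b n → (a * b) ^ n ≡ a ^ n * b ^ n
*-^-distrib a b zero    = refl
*-^-distrib a b (suc n) rewrite *-^-distrib a b n = interchange a b (a ^ n) (b ^ n)
  where
  interchange : ∀ a b x y → a * b * (x * y) ≡ a * x * (b * y)
  interchange = solve-∀

BoundFor : ℕ → Set
BoundFor m = Σ ℕ (λ K → 0 < K × Σ ℕ (λ N → (n : ℕ) → N ≤ n → 2 ∣ n →
  α m n ^ 2 * n ^ (m ∸ 1) ≤ K ^ 2 * (m C (m / 2)) ^ (2 * n)))

module _ (p : ℕ) where

  private
    m d : ℕ
    m = suc (suc (p + p))
    d = suc (p + p)

  -- Each column step of extensions is encoded by column-encoding; only rows 1..d are kept.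
  extensions-encoding : ∀ n (s : Vec ℤ m) →
    suc p ^ n * extensions m n s ≤
    ΣV (positions d) n (λ js → ΣV (balancedWords p) n (λ ws → signPatterns (V.tail s) js ws))
  extensions-encoding zero    (z ∷ t) =   -- forgetting row 0 only weakens the final condition
    ≤-trans (≤-reflexive (trans (+-identityʳ _) (ind-∧ (small z) (allSmall t))))
            (≤-trans (*-monoˡ-≤ (ind (allSmall t)) (ind≤1 (small z))) (≤-reflexive (+-identityʳ _)))
  extensions-encoding (suc n) (z ∷ t) = begin
    suc p ^ suc n * ΣV signs m (λ c → ind (smallSum c) * extensions m n ((z ∷ t) ⊕ c))
      ≡⟨ trans (sym (ΣV-* signs m (suc p ^ suc n) (λ c → ind (smallSum c) * extensions m n ((z ∷ t) ⊕ c)))) (ΣV-cong signs m (λ c → reorder (suc p) (suc p ^ n) (ind (smallSum c)) (extensions m n ((z ∷ t) ⊕ c)))) ⟩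
    ΣV signs m (λ c → ind (smallSum c) * (suc p * (suc p ^ n * extensions m n ((z ∷ t) ⊕ c))))
      ≤⟨ ΣV-mono signs m (λ c → *-monoʳ-≤ (ind (smallSum c)) (*-monoʳ-≤ (suc p) (extensions-encoding n ((z ∷ t) ⊕ c)))) ⟩
    ΣV signs m (λ c → ind (smallSum c) * (suc p * Rest c))
      ≤⟨ column-encoding p Rest ⟩
    ΣL (positions d) (λ j → ΣL (balancedWords p) (λ w → ΣL signs (λ ε → Rest (ε ∷ insertAt w j (not ε)))))
      ≡⟨ ΣL-cong (positions d) exchange ⟩
    ΣV (positions d) (suc n) (λ js → ΣV (balancedWords p) (suc n) (λ ws → signPatterns t js ws)) ∎
    where
    open ≤-Reasoning
    Rest : Vec Bool m → ℕ
    Rest c = ΣV (positions d) n (λ js → ΣV (balancedWords p) n (λ ws → signPatterns (V.tail ((z ∷ t) ⊕ c)) js ws))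
    reorder : ∀ a an i x → a * an * (i * x) ≡ i * (a * (an * x))
    reorder = solve-∀
    F : Fin d → Vec Bool (p + p) → Bool → Vec (Fin d) n → Vec (Vec Bool (p + p)) n → ℕ
    F j w ε js ws = signPatterns (t ⊕ insertAt w j (not ε)) js ws
    exchange : ∀ j → ΣL (balancedWords p) (λ w → ΣL signs (λ ε → ΣV (positions d) n (λ js → ΣV (balancedWords p) n (F j w ε js)))) ≡
                     ΣV (positions d) n (λ js → ΣL (balancedWords p) (λ w → ΣV (balancedWords p) n (λ ws → ΣL signs (λ ε → F j w ε js ws))))
    exchange j =
      trans (ΣL-cong (balancedWords p) (λ w →
               trans (ΣLV-swap signs (positions d) n (λ ε js → ΣV (balancedWords p) n (F j w ε js)))
                     (ΣV-cong (positions d) n (λ js → ΣLV-swap signs (balancedWords p) n (λ ε ws → F j w ε js ws)))))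
            (ΣLV-swap (balancedWords p) (positions d) n (λ w js → ΣV (balancedWords p) n (λ ws → ΣL signs (λ ε → F j w ε js ws))))

  profileBound : ℕ → ℕ
  profileBound n = ΣV (positions d) n (λ js → Πv rowBound (profile js))

  α-profile-bound : ∀ n → suc p ^ n * α m n ≤ bin₂ p p ^ n * profileBound n
  α-profile-bound n = begin
    suc p ^ n * α m n                                   ≡⟨ cong (suc p ^ n *_) (α≡extensions m n) ⟩
    suc p ^ n * extensions m n zeros                    ≤⟨ extensions-encoding n zeros ⟩
    ΣV (positions d) n (λ js → ΣV W n (λ ws → signPatterns (replicate d (+ᶻ 0)) js ws))
      ≤⟨ ΣV-mono (positions d) n (λ js → ΣV-mono W n (λ ws → signPatterns≤Π js ws (replicate d (+ᶻ 0)))) ⟩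
    ΣV (positions d) n (λ js → ΣV W n (λ _ → Πv rowBound (profile js)))
      ≡⟨ ΣV-cong (positions d) n (λ js → ΣV-const W n (Πv rowBound (profile js))) ⟩
    ΣV (positions d) n (λ js → length W ^ n * Πv rowBound (profile js))
      ≡⟨ ΣV-* (positions d) n (length W ^ n) (λ js → Πv rowBound (profile js)) ⟩
    length W ^ n * profileBound n                       ≡⟨ cong (λ x → x ^ n * profileBound n) (length-balancedWords p) ⟩
    bin₂ p p ^ n * profileBound n                       ∎
    where
    open ≤-Reasoning
    zeros = replicate m (+ᶻ 0)
    W = balancedWords p

  profileBound-cauchy-schwarz : ∀ n → profileBound n * profileBound n ≤ d ^ n * profileSum (λ N → rowBound N * rowBound N) d n
  profileBound-cauchy-schwarz n = ≤-trans (ΣV-cauchy-schwarz (positions d) n (λ js → Πv rowBound (profile js)))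
    (≤-reflexive (cong₂ _*_ (cong (_^ n) (length-positions d)) (ΣV-cong (positions d) n (λ js → Πv-sq rowBound (profile js)))))

  rowBound²-bound : ∀ N → rowBound N * rowBound N * suc N ≤ 4 * 4 ^ N
  rowBound²-bound N = ≤-trans (*-monoʳ-≤ (rowBound N * rowBound N) (n≤1+n (suc N))) (maxBin-bound (suc N))

  central-step^n : ∀ n → bin₂ (suc p) (suc p) ^ n * suc p ^ n ≡ 2 ^ n * d ^ n * bin₂ p p ^ n
  central-step^n n = begin
    bin₂ (suc p) (suc p) ^ n * suc p ^ n  ≡⟨ sym (*-^-distrib (bin₂ (suc p) (suc p)) (suc p) n) ⟩
    (bin₂ (suc p) (suc p) * suc p) ^ n    ≡⟨ cong (_^ n) (trans (central-step p) (cong (λ x → 2 * x * bin₂ p p) (+-comm (p + p) 1))) ⟩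
    (2 * d * bin₂ p p) ^ n                ≡⟨ *-^-distrib (2 * d) (bin₂ p p) n ⟩
    (2 * d) ^ n * bin₂ p p ^ n            ≡⟨ cong (_* bin₂ p p ^ n) (*-^-distrib 2 d n) ⟩
    2 ^ n * d ^ n * bin₂ p p ^ n          ∎
    where open ≡-Reasoning

  -- The main inequality α(m,n)² n^d ≤ 4^d d^d C(m, m/2)^(2n), after multiplying both sides by (p+1)^(2n).
  α²-bound : ∀ n → α m n * α m n * n ^ d ≤ (4 ^ d * d ^ d) * (bin₂ (suc p) (suc p) ^ n * bin₂ (suc p) (suc p) ^ n)
  α²-bound n = *-cancelˡ-≤ (a * a) {{m*n≢0 a a {{m^n≢0 (suc p) n}} {{m^n≢0 (suc p) n}}}} (begin
    a * a * (α m n * α m n * n ^ d)            ≡⟨ regroup a (α m n) (n ^ d) ⟩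
    (a * α m n) * (a * α m n) * n ^ d          ≤⟨ *-mono-≤ (*-mono-≤ (α-profile-bound n) (α-profile-bound n)) (n^d≤rising n d) ⟩
    (β * P) * (β * P) * R                      ≡⟨ regroup′ β P R ⟩
    β * β * (P * P) * R                        ≤⟨ *-monoˡ-≤ R (*-monoʳ-≤ (β * β) (profileBound-cauchy-schwarz n)) ⟩
    β * β * (d ^ n * S) * R                    ≡⟨ regroup″ β (d ^ n) S R ⟩
    β * β * d ^ n * (S * R)                    ≤⟨ *-monoʳ-≤ (β * β * d ^ n) (profileSum-bound (λ N → rowBound N * rowBound N) 4 rowBound²-bound d n) ⟩
    β * β * d ^ n * (4 ^ d * 4 ^ n * d ^ (n + d)) ≡⟨ cong₂ (λ x y → β * β * d ^ n * (4 ^ d * x * y)) (*-^-distrib 2 2 n) (^-distribˡ-+-* d n d) ⟩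
    β * β * d ^ n * (4 ^ d * (2 ^ n * 2 ^ n) * (d ^ n * d ^ d))
      ≡⟨ collect β (d ^ n) (4 ^ d) (2 ^ n) (d ^ d) ⟩
    (4 ^ d * d ^ d) * ((2 ^ n * d ^ n * β) * (2 ^ n * d ^ n * β))
      ≡⟨ cong (λ x → (4 ^ d * d ^ d) * (x * x)) (sym (central-step^n n)) ⟩
    (4 ^ d * d ^ d) * ((Cn * a) * (Cn * a))    ≡⟨ regroup‴ (4 ^ d * d ^ d) Cn a ⟩
    a * a * ((4 ^ d * d ^ d) * (Cn * Cn))      ∎)
    where
    open ≤-Reasoning
    a = suc p ^ n
    β = bin₂ p p ^ n
    Cn = bin₂ (suc p) (suc p) ^ n
    P = profileBound n
    S = profileSum (λ N → rowBound N * rowBound N) d n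
    R = rising n d
    regroup : ∀ a X y → a * a * (X * X * y) ≡ (a * X) * (a * X) * y
    regroup = solve-∀
    regroup′ : ∀ r P R → (r * P) * (r * P) * R ≡ r * r * (P * P) * R
    regroup′ = solve-∀
    regroup″ : ∀ r dn S R → r * r * (dn * S) * R ≡ r * r * dn * (S * R)
    regroup″ = solve-∀
    collect : ∀ r dn fd tn dd → r * r * dn * (fd * (tn * tn) * (dn * dd)) ≡ (fd * dd) * ((tn * dn * r) * (tn * dn * r))
    collect = solve-∀
    regroup‴ : ∀ k c a → k * ((c * a) * (c * a)) ≡ a * a * (k * (c * c))
    regroup‴ = solve-∀

  central^2n : ∀ n → (m C (m / 2)) ^ (2 * n) ≡ bin₂ (suc p) (suc p) ^ n * bin₂ (suc p) (suc p) ^ n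
  central^2n n = begin
    (m C (m / 2)) ^ (2 * n)     ≡⟨ cong (λ x → (m C x) ^ (2 * n)) m/2≡p+1 ⟩
    (m C suc p) ^ (2 * n)       ≡⟨ cong (_^ (2 * n)) (trans (C≡bin m (suc p)) (trans (cong (λ x → bin x (suc p)) m≡[p+1]+[p+1]) (bin≡bin₂ (suc p) (suc p)))) ⟩
    bin₂ (suc p) (suc p) ^ (2 * n) ≡⟨ cong (bin₂ (suc p) (suc p) ^_) (double n) ⟩
    bin₂ (suc p) (suc p) ^ (n + n) ≡⟨ ^-distribˡ-+-* _ n n ⟩
    bin₂ (suc p) (suc p) ^ n * bin₂ (suc p) (suc p) ^ n ∎
    where
    open ≡-Reasoning
    m≡[p+1]*2 : ∀ p → suc (suc (p + p)) ≡ suc p * 2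
    m≡[p+1]*2 = solve-∀
    m/2≡p+1 : m / 2 ≡ suc p
    m/2≡p+1 = trans (cong (_/ 2) (m≡[p+1]*2 p)) (m*n/n≡m (suc p) 2)
    m≡[p+1]+[p+1] : m ≡ suc p + suc p
    m≡[p+1]+[p+1] = cong suc (sym (+-suc p p))
    double : ∀ n → 2 * n ≡ n + n
    double = solve-∀

  theorem-for-2[p+1] : BoundFor m
  theorem-for-2[p+1] = K , K>0 , 0 , λ n _ _ → bound n
    where
    open ≤-Reasoning
    K = 4 ^ d * d ^ d
    K>0 : 0 < K
    K>0 = *-mono-≤ (m^n>0 4 d) (m^n>0 d d)
    bound : ∀ n → α m n ^ 2 * n ^ (m ∸ 1) ≤ K ^ 2 * (m C (m / 2)) ^ (2 * n)
    bound n = begin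
      α m n ^ 2 * n ^ d                    ≡⟨ cong (λ x → α m n * x * n ^ d) (*-identityʳ (α m n)) ⟩
      α m n * α m n * n ^ d                ≤⟨ α²-bound n ⟩
      K * (Cn * Cn)                        ≤⟨ *-monoˡ-≤ (Cn * Cn) (≤-trans (≤-reflexive (sym (*-identityʳ K))) (*-monoʳ-≤ K (≤-trans K>0 (≤-reflexive (sym (*-identityʳ K)))))) ⟩
      K ^ 2 * (Cn * Cn)                    ≡⟨ cong (K ^ 2 *_) (sym (central^2n n)) ⟩
      K ^ 2 * (m C (m / 2)) ^ (2 * n)      ∎
      where
      Cn = bin₂ (suc p) (suc p) ^ n

theorem9 : (m : ℕ) → 0 < m → 2 ∣ m →
    Σ ℕ (λ K → 0 < K × Σ ℕ (λ N → (n : ℕ) → N ≤ n → 2 ∣ n →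
    α m n ^ 2 * n ^ (m ∸ 1) ≤ K ^ 2 * (m C (m / 2)) ^ (2 * n)))
theorem9 m 0<m (divides zero    m≡0)        = ⊥-elim (<-irrefl refl (subst (0 <_) m≡0 0<m))
theorem9 m 0<m (divides (suc p) m≡[p+1]*2) =
  subst BoundFor (sym (trans m≡[p+1]*2 (double p))) (theorem-for-2[p+1] p)
  where
  double : ∀ p → suc p * 2 ≡ suc (suc (p + p))
  double = solve-∀
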